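{- Let $\Gamma$ be a distance-regular graph with minimum eigenvalue $\theta_d$ which is geometric with respect to a set $\mathcal{K}$ of Delsarte cliques. Let $C$ be a completely regular code in $\Gamma$ with covering radius $\rho$, distance partition $C_0=C,\dots,C_\rho$, and $\theta_d\in Spec(C)$. Let $C'_i=\{K\in\mathcal{K}: K\subset C_i\cup C_{i+1}\}$ for $i\in\{0,\dots,\rho-1\}$ (and $C'_{ -1}=C'_\rho=\emptyset$). Let $x$ be a vertex of $C_i$, $i\in\{0,\dots,\rho\}$. Then $x$ is contained only in cliques from $C'_{i-1}$ and $C'_i$, and the number of cliques from $C'_{i-1}$ containing $x$ is $b_i$, where $b_i$ depends only on $i$ and the intersection arrays of $C$ and $\Gamma$. Moreover $b_0=0$, $b_\rho=-\theta_d$, and $0<b_i<-\theta_d$ for $i\in\{1,\dots,\rho-1\}$.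
   Context: A distance-regular graph of valency $k$ and diameter $d$ has distinct eigenvalues $\theta_0=k>\dots>\theta_d$; its intersection array is $\{\beta_0,\dots,\beta_{d-1};\gamma_1,\dots,\gamma_d\}$ (for vertices $x,y$ at distance $i$, $y$ has $\beta_i$ neighbours at distance $i+1$ and $\gamma_i$ at distance $i-1$ from $x$). A Delsarte clique is a clique of size $1-\frac{k}{\theta_d}$. $\Gamma$ is geometric with respect to a set $\mathcal{K}$ of Delsarte cliques if every edge lies in exactly one clique of $\mathcal{K}$. For a code $C$, $C_i$ is the set of vertices at distance exactly $i$ from $C$, $\rho$ (covering radius) is the largest $i$ with $C_i\neq\emptyset$. $C$ is completely regular if there are numbers $\alpha_i,\beta_i,\gamma_i$ such that each vertex of $C_i$ has exactly $\alpha_i,\beta_i,\gamma_i$ neighbours in $C_i,C_{i+1},C_{i-1}$; its intersection array is $\{\beta_0,\dots,\beta_{\rho-1};\gamma_1,\dots,\gamma_\rho\}$, and $Spec(C)$ is the set of eigenvalues of the tridiagonal intersection matrix with diagonal $\alpha_0,\dots,\alpha_\rho$, superdiagonal $\beta_0,\dots,\beta_{\rho-1}$, subdiagonal $\gamma_1,\dots,\gamma_\rho$. -}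

module Defs where

open import Data.Nat using (ℕ; zero; suc; _+_; _<ᵇ_; _≤_)
open import Data.Bool using (Bool; true; false; _∧_; _∨_; not; if_then_else_)
open import Data.Fin using (Fin; zero; suc; _≟_)
open import Data.Fin.Subset using (Subset)
open import Data.Vec using (Vec; []; _∷_; lookup)
open import Data.List using (List; []; _∷_)
open import Data.List.Relation.Unary.All using (All)
open import Data.List.Relation.Unary.Unique.Propositional using (Unique)
open import Data.Integer as ℤ using (ℤ; +_; -_)
open import Data.Product using (Σ; _×_; ∃; ∃₂)
open import Relation.Nullary using (¬_)
open import Relation.Nullary.Decidable using (⌊_⌋)
open import Relation.Binary.PropositionalEquality using (_≡_; _≢_)

anyF : ∀ {n} → (Fin n → Bool) → Bool
anyF {zero}  p = false
anyF {suc n} p = p zero ∨ anyF (λ i → p (suc i))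

allF : ∀ {n} → (Fin n → Bool) → Bool
allF {zero}  p = true
allF {suc n} p = p zero ∧ allF (λ i → p (suc i))

countF : ∀ {n} → (Fin n → Bool) → ℕ
countF {zero}  p = 0
countF {suc n} p = (if p zero then 1 else 0) + countF (λ i → p (suc i))

sumZ : ∀ {n} → (Fin n → ℤ) → ℤ
sumZ {zero}  f = + 0
sumZ {suc n} f = f zero ℤ.+ sumZ (λ i → f (suc i))

countL : ∀ {A : Set} → (A → Bool) → List A → ℕ
countL p []       = 0
countL p (a ∷ as) = (if p a then 1 else 0) + countL p as

-- lookup in a vector of naturals, 0 outside the range
getV : ∀ {m} → Vec ℕ m → ℕ → ℕ
getV []       i       = 0
getV (x ∷ xs) zero    = x
getV (x ∷ xs) (suc i) = getV xs i

record Graph : Set where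
  field
    V      : ℕ
    adj    : Fin V → Fin V → Bool
    adj-sym    : ∀ x y → adj x y ≡ adj y x
    adj-irrefl : ∀ x → adj x x ≡ false

module _ (G : Graph) where
  open Graph G

  within : ℕ → Fin V → Fin V → Bool
  within zero    x y = ⌊ x ≟ y ⌋
  within (suc i) x y = within i x y ∨ anyF (λ z → adj x z ∧ within i z y)

  atDist : ℕ → Fin V → Fin V → Bool
  atDist zero    x y = within zero x y
  atDist (suc i) x y = within (suc i) x y ∧ not (within i x y)

  -- Distance-regular graph of valency k, diameter d, intersection array
  -- {bs[0],…,bs[d-1]; cs[0],…,cs[d-1]} = {β_0,…,β_{d-1}; γ_1,…,γ_d}.
  record IsDRG (k d : ℕ) (bs cs : Vec ℕ d) : Set where
    field
      regular   : ∀ x → countF (adj x) ≡ k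
      connected : ∀ x y → within d x y ≡ true
      diameter  : ∃₂ λ x y → atDist d x y ≡ true
      β-const   : ∀ i → suc i ≤ d → ∀ x y → atDist i x y ≡ true →
                  countF (λ z → adj y z ∧ atDist (suc i) x z) ≡ getV bs i
      γ-const   : ∀ i → suc i ≤ d → ∀ x y → atDist (suc i) x y ≡ true →
                  countF (λ z → adj y z ∧ atDist i x z) ≡ getV cs i

  A· : (Fin V → ℤ) → Fin V → ℤ
  A· v x = sumZ (λ y → if adj x y then v y else + 0)

  -- θ is an eigenvalue of the adjacency matrix (θ integer: a nonzero
  -- rational, equivalently integer, eigenvector exists)
  IsEigenvalue : ℤ → Set
  IsEigenvalue θ = Σ (Fin V → ℤ) λ v → (∃ λ x → v x ≢ + 0) × (∀ x → A· v x ≡ θ ℤ.* v x)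

  -- θ is the minimum eigenvalue: an eigenvalue, and A - θI is positive
  -- semidefinite (no eigenvalue below θ).
  IsMinEigenvalue : ℤ → Set
  IsMinEigenvalue θ = IsEigenvalue θ ×
    (∀ (v : Fin V → ℤ) → θ ℤ.* sumZ (λ x → v x ℤ.* v x) ℤ.≤ sumZ (λ x → v x ℤ.* A· v x))

  IsClique : Subset V → Set
  IsClique K = ∀ x y → lookup K x ≡ true → lookup K y ≡ true → x ≢ y → adj x y ≡ true

  -- Delsarte clique: clique of size 1 - k/θ, i.e. size·θ = θ - k
  IsDelsarteClique : ℕ → ℤ → Subset V → Set
  IsDelsarteClique k θ K = IsClique K × ((+ countF (lookup K)) ℤ.* θ ≡ θ ℤ.- (+ k))

  IsGeometric : ℕ → ℤ → List (Subset V) → Set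
  IsGeometric k θ 𝒦 = Unique 𝒦 × All (IsDelsarteClique k θ) 𝒦 ×
    (∀ x y → adj x y ≡ true → countL (λ K → lookup K x ∧ lookup K y) 𝒦 ≡ 1)

  module _ (C : Subset V) where
    withinC : ℕ → Fin V → Bool
    withinC i x = anyF (λ c → lookup C c ∧ within i x c)

    atC : ℕ → Fin V → Bool
    atC zero    x = withinC zero x
    atC (suc i) x = withinC (suc i) x ∧ not (withinC i x)

    -- completely regular code with covering radius ρ, numbers
    -- α_0..α_ρ = al, β_0..β_{ρ-1} = be, γ_1..γ_ρ = ga
    record IsCRC (ρ : ℕ) (al : Vec ℕ (suc ρ)) (be ga : Vec ℕ ρ) : Set where
      field
        covers   : ∀ x → withinC ρ x ≡ true
        radius   : ∃ λ x → atC ρ x ≡ true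
        α-const  : ∀ i → i ≤ ρ → ∀ x → atC i x ≡ true →
                   countF (λ z → adj x z ∧ atC i z) ≡ getV al i
        β-const  : ∀ i → suc i ≤ ρ → ∀ x → atC i x ≡ true →
                   countF (λ z → adj x z ∧ atC (suc i) z) ≡ getV be i
        γ-const  : ∀ i → suc i ≤ ρ → ∀ x → atC (suc i) x ≡ true →
                   countF (λ z → adj x z ∧ atC i z) ≡ getV ga i

    inC' : ℕ → ℕ → Subset V → Bool
    inC' ρ j K = (j <ᵇ ρ) ∧ allF (λ y → not (lookup K y) ∨ (atC j y ∨ atC (suc j) y))

    inC'prev : ℕ → ℕ → Subset V → Bool
    inC'prev ρ zero    K = false
    inC'prev ρ (suc j) K = inC' ρ j K

-- Spectrum of the (ρ+1)×(ρ+1) tridiagonal intersection matrix of a code: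
-- row i is  γ_i u_{i-1} + α_i u_i + β_i u_{i+1}.

triRow : ∀ {ρ} → Vec ℕ (suc ρ) → Vec ℕ ρ → Vec ℕ ρ → (ℕ → ℤ) → ℕ → ℤ
triRow al be ga u i = γpart i ℤ.+ ((+ getV al i) ℤ.* u i) ℤ.+ ((+ getV be i) ℤ.* u (suc i))
  where
  γpart : ℕ → ℤ
  γpart zero    = + 0
  γpart (suc j) = (+ getV ga j) ℤ.* u j

InSpec : (ρ : ℕ) → ℤ → Vec ℕ (suc ρ) → Vec ℕ ρ → Vec ℕ ρ → Set
InSpec ρ θ al be ga = Σ (ℕ → ℤ) λ u →
  (∃ λ i → i ≤ ρ × u i ≢ + 0) ×
  (∀ i → i ≤ ρ → triRow al be ga u i ≡ θ ℤ.* u i)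

{-# OPTIONS --safe #-}
-- Counting the pairs (y, K) with x, y ∈ K ∈ 𝒦 in two ways shows that every vertex x lies in exactly m = −θ
-- cliques of 𝒦.
-- An eigenvector u of the intersection matrix for θ lifts to the θ-eigenvector f = u ∘ layer of Γ, and
-- Σ_K (Σ_{y∈K} f y)² = Σ_x f x ((A f) x + m f x) = 0, so f sums to zero on every clique of 𝒦.
-- Adjacent vertices lie in the same or in consecutive layers, so a clique through x ∈ C_i lies in
-- C_{i−1} ∪ C_i or in C_i ∪ C_{i+1}. For x ∈ C_{j+1}, adding up the vanishing clique sums over the
-- cliques of C'_j through x gives m γ_{j+1} (u_j − u_{j+1}) + b_{j+1} (m + k) u_{j+1} = 0, and b_{j+1} is
-- read off after writing u_i through the characteristic-polynomial recursion of the intersection matrix.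
-- On C_ρ every clique through x lies in C'_{ρ−1}, so b_ρ = m; for 0 < i < ρ a neighbour of x in C_{i−1}
-- and one in C_{i+1} give a clique of C'_{i−1} through x and one outside it, so 0 < b_i < m.
module Submission where

open import Defs
open import Data.Nat as ℕ using (ℕ; zero; suc; _≤_; _<_; _∸_; _<ᵇ_; z≤n; s≤s)
import Data.Nat.Properties as ℕP
open import Data.Nat.DivMod using (m*n/n≡m)
open import Data.Bool using (Bool; true; false; _∧_; _∨_; not; if_then_else_)
open import Data.Bool.Properties using (∧-zeroʳ; ∧-identityʳ; ∧-idem; ∧-comm; ∨-zeroʳ; ¬-not; T-≡)
open import Data.Fin using (Fin; zero; suc) renaming (_≟_ to _≟ᶠ_)
open import Data.Fin.Subset using (Subset)
open import Data.Vec using (Vec; []; _∷_; lookup)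
open import Data.List using (List; []; _∷_)
open import Data.List.Membership.Propositional using (_∈_)
open import Data.List.Relation.Unary.Any using (here; there)
import Data.List.Relation.Unary.All as All
open import Data.Integer as ℤ using (ℤ; +_; -_; _+_; _*_; _-_)
import Data.Integer.Properties as ℤP
open import Data.Integer.Tactic.RingSolver using (solve-∀)
open import Data.Product using (Σ-syntax; _×_; _,_; ∃; ∃₂; proj₁; proj₂)
open import Data.Sum as Sum using (_⊎_; inj₁; inj₂; [_,_]′)
open import Relation.Binary.Definitions using (tri<; tri≈; tri>)
open import Relation.Nullary using (yes; no; contradiction)
open import Relation.Nullary.Decidable using (⌊_⌋)
open import Relation.Binary.PropositionalEquality
open import Function using (_∘_)
open import Function.Bundles using (Equivalence)

∧-true : ∀ a {b} → a ∧ b ≡ true → a ≡ true × b ≡ true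
∧-true true p = refl , p

Bool-dichotomy : ∀ b → b ≡ true ⊎ b ≡ false
Bool-dichotomy true  = inj₁ refl
Bool-dichotomy false = inj₂ refl

∨-true : ∀ a {b} → a ∨ b ≡ true → a ≡ true ⊎ b ≡ true
∨-true true  _ = inj₁ refl
∨-true false p = inj₂ p

∨-introʳ : ∀ a {b} → b ≡ true → a ∨ b ≡ true
∨-introʳ a refl = ∨-zeroʳ a

true⇒≢false : ∀ {a} → a ≡ true → a ≢ false
true⇒≢false refl ()

not-true : ∀ {a} → not a ≡ true → a ≡ false
not-true {false} _ = refl

if-true : ∀ {A : Set} {b} {x y : A} → b ≡ true → (if b then x else y) ≡ x
if-true refl = refl

if-false : ∀ {A : Set} {b} {x y : A} → b ≡ false → (if b then x else y) ≡ y
if-false refl = refl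

≟ᶠ-refl : ∀ {n} (x : Fin n) → ⌊ x ≟ᶠ x ⌋ ≡ true
≟ᶠ-refl x with x ≟ᶠ x
... | yes _ = refl
... | no x≢x = contradiction refl x≢x

square-nonneg : ∀ a → + 0 ℤ.≤ a * a
square-nonneg (+ n)      = subst (+ 0 ℤ.≤_) (ℤP.pos-* n n) (ℤ.+≤+ z≤n)
square-nonneg ℤ.-[1+ n ] = subst (+ 0 ℤ.≤_) (trans (ℤP.pos-* (suc n) (suc n)) (neg-square (+ suc n))) (ℤ.+≤+ z≤n)
  where
  neg-square : ∀ a → a * a ≡ (- a) * (- a)
  neg-square = solve-∀

square≡0 : ∀ a → a * a ≡ + 0 → a ≡ + 0
square≡0 a eq = Sum.reduce (ℤP.i*j≡0⇒i≡0∨j≡0 a eq)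

nonneg-+≡0 : ∀ {a b} → + 0 ℤ.≤ a → + 0 ℤ.≤ b → a + b ≡ + 0 → a ≡ + 0 × b ≡ + 0
nonneg-+≡0 {+ zero} {+ zero} _ _ _ = refl , refl

*≡0-cancelˡ : ∀ a {b} → a ≢ + 0 → a * b ≡ + 0 → b ≡ + 0
*≡0-cancelˡ a a≢0 eq = [ (λ p → contradiction p a≢0) , (λ p → p) ]′ (ℤP.i*j≡0⇒i≡0∨j≡0 a eq)

countF-cong : ∀ {n} (p q : Fin n → Bool) → (∀ i → p i ≡ q i) → countF p ≡ countF q
countF-cong {zero}  p q eq = refl
countF-cong {suc n} p q eq =
  cong₂ ℕ._+_ (cong (λ b → if b then 1 else 0) (eq zero)) (countF-cong _ _ (λ i → eq (suc i)))

countF-none : ∀ {n} (p : Fin n → Bool) → (∀ i → p i ≡ false) → countF p ≡ 0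
countF-none {zero}  p none = refl
countF-none {suc n} p none rewrite none zero = countF-none _ (λ i → none (suc i))

countF-positive : ∀ {n} (p : Fin n → Bool) i → p i ≡ true → 1 ≤ countF p
countF-positive p zero    pi rewrite pi = s≤s z≤n
countF-positive p (suc i) pi =
  ℕP.≤-trans (countF-positive _ i pi) (ℕP.m≤n+m _ (if p zero then 1 else 0))

countF-positive⇒∃ : ∀ {n} (p : Fin n → Bool) → 1 ≤ countF p → ∃ λ i → p i ≡ true
countF-positive⇒∃ {suc n} p pos with p zero in p0
... | true  = zero , p0
... | false with countF-positive⇒∃ (λ i → p (suc i)) pos
...   | i , pi = suc i , pi

countF-≥2 : ∀ {n} (p : Fin n → Bool) x y → p x ≡ true → p y ≡ true → x ≢ y → 2 ≤ countF p
countF-≥2 p zero    zero    px py x≢y = contradiction refl x≢y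
countF-≥2 p zero    (suc y) px py x≢y rewrite px = s≤s (countF-positive _ y py)
countF-≥2 p (suc x) zero    px py x≢y rewrite py = s≤s (countF-positive _ x px)
countF-≥2 p (suc x) (suc y) px py x≢y =
  ℕP.≤-trans (countF-≥2 _ x y px py (λ eq → x≢y (cong suc eq))) (ℕP.m≤n+m _ (if p zero then 1 else 0))

countF-partition : ∀ {n} (p q r : Fin n → Bool) →
  (∀ i → p i ≡ true → q i ≡ true ⊎ r i ≡ true) → (∀ i → q i ≡ true → r i ≡ false) →
  countF p ≡ countF (λ i → p i ∧ q i) ℕ.+ countF (λ i → p i ∧ r i)
countF-partition {zero}  p q r cover disjoint = refl
countF-partition {suc n} p q r cover disjoint with p zero in p0
... | false = rest
  where rest = countF-partition _ _ _ (λ i → cover (suc i)) (λ i → disjoint (suc i))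
... | true with cover zero p0
...   | inj₁ q0 rewrite q0 | disjoint zero q0 =
          cong suc (countF-partition _ _ _ (λ i → cover (suc i)) (λ i → disjoint (suc i)))
...   | inj₂ r0 with q zero in q0
...     | true  = contradiction (disjoint zero q0) (true⇒≢false r0)
...     | false rewrite r0 =
          trans (cong suc (countF-partition _ _ _ (λ i → cover (suc i)) (λ i → disjoint (suc i))))
                (sym (ℕP.+-suc _ _))

sumZ-cong : ∀ {n} (f g : Fin n → ℤ) → (∀ i → f i ≡ g i) → sumZ f ≡ sumZ g
sumZ-cong {zero}  f g eq = refl
sumZ-cong {suc n} f g eq = cong₂ _+_ (eq zero) (sumZ-cong _ _ (λ i → eq (suc i)))

sumZ-zero : ∀ {n} (f : Fin n → ℤ) → (∀ i → f i ≡ + 0) → sumZ f ≡ + 0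
sumZ-zero {zero}  f f≡0 = refl
sumZ-zero {suc n} f f≡0 rewrite f≡0 zero = trans (ℤP.+-identityˡ _) (sumZ-zero _ (λ i → f≡0 (suc i)))

sumZ-+ : ∀ {n} (f g : Fin n → ℤ) → sumZ (λ i → f i + g i) ≡ sumZ f + sumZ g
sumZ-+ {zero}  f g = refl
sumZ-+ {suc n} f g rewrite sumZ-+ (λ i → f (suc i)) (λ i → g (suc i)) =
  interchange (f zero) (g zero) (sumZ (λ i → f (suc i))) (sumZ (λ i → g (suc i)))
  where
  interchange : ∀ a b c d → a + b + (c + d) ≡ a + c + (b + d)
  interchange = solve-∀

sumZ-*ˡ : ∀ {n} c (f : Fin n → ℤ) → sumZ (λ i → c * f i) ≡ c * sumZ f
sumZ-*ˡ {zero}  c f = sym (ℤP.*-zeroʳ c)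
sumZ-*ˡ {suc n} c f rewrite sumZ-*ˡ c (λ i → f (suc i)) = sym (ℤP.*-distribˡ-+ c (f zero) _)

sumZ-*ʳ : ∀ {n} c (f : Fin n → ℤ) → sumZ (λ i → f i * c) ≡ sumZ f * c
sumZ-*ʳ c f = trans (sumZ-cong _ _ (λ i → ℤP.*-comm (f i) c)) (trans (sumZ-*ˡ c f) (ℤP.*-comm c _))

sumZ-indicator : ∀ {n} (p : Fin n → Bool) c → sumZ (λ i → if p i then c else + 0) ≡ + countF p * c
sumZ-indicator {zero}  p c = refl
sumZ-indicator {suc n} p c rewrite sumZ-indicator (λ i → p (suc i)) c with p zero
... | true  = trans (cong (λ a → a + + countF (λ i → p (suc i)) * c) (sym (ℤP.*-identityˡ c)))
                    (sym (ℤP.*-distribʳ-+ c (+ 1) (+ countF (λ i → p (suc i)))))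
... | false = ℤP.+-identityˡ _

countF≡sumZ : ∀ {n} (p : Fin n → Bool) → + countF p ≡ sumZ (λ i → if p i then + 1 else + 0)
countF≡sumZ p = sym (trans (sumZ-indicator p (+ 1)) (ℤP.*-identityʳ _))

sumZ-diagonal : ∀ {n} (x : Fin n) (g : Fin n → ℤ) → sumZ (λ y → if ⌊ x ≟ᶠ y ⌋ then g y else + 0) ≡ g x
sumZ-diagonal {suc n} zero    g = trans (cong (λ s → g zero + s) (sumZ-zero {n} _ (λ _ → refl))) (ℤP.+-identityʳ _)
sumZ-diagonal {suc n} (suc x) g =
  trans (ℤP.+-identityˡ _) (trans (sumZ-cong _ _ shift) (sumZ-diagonal x (λ i → g (suc i))))
  where
  shift : ∀ y → (if ⌊ suc x ≟ᶠ suc y ⌋ then g (suc y) else + 0) ≡ (if ⌊ x ≟ᶠ y ⌋ then g (suc y) else + 0)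
  shift y with x ≟ᶠ y
  ... | yes refl = refl
  ... | no _     = refl

sumZ-nonneg : ∀ {n} (f : Fin n → ℤ) → (∀ i → + 0 ℤ.≤ f i) → + 0 ℤ.≤ sumZ f
sumZ-nonneg {zero}  f nonneg = ℤ.+≤+ z≤n
sumZ-nonneg {suc n} f nonneg = ℤP.+-mono-≤ (nonneg zero) (sumZ-nonneg _ (λ i → nonneg (suc i)))

sumZ-≥-term : ∀ {n} (f : Fin n → ℤ) → (∀ i → + 0 ℤ.≤ f i) → ∀ i → f i ℤ.≤ sumZ f
sumZ-≥-term f nonneg zero =
  subst (ℤ._≤ sumZ f) (ℤP.+-identityʳ (f zero))
        (ℤP.+-monoʳ-≤ (f zero) (sumZ-nonneg _ (λ i → nonneg (suc i))))
sumZ-≥-term f nonneg (suc i) =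
  subst (ℤ._≤ sumZ f) (ℤP.+-identityˡ (f (suc i)))
        (ℤP.+-mono-≤ (nonneg zero) (sumZ-≥-term _ (λ j → nonneg (suc j)) i))

anyF⇒∃ : ∀ {n} (p : Fin n → Bool) → anyF p ≡ true → ∃ λ i → p i ≡ true
anyF⇒∃ {suc n} p any with p zero in p0
... | true  = zero , p0
... | false with anyF⇒∃ (λ i → p (suc i)) any
...   | i , pi = suc i , pi

∃⇒anyF : ∀ {n} (p : Fin n → Bool) i → p i ≡ true → anyF p ≡ true
∃⇒anyF p zero    pi rewrite pi = refl
∃⇒anyF p (suc i) pi = ∨-introʳ (p zero) (∃⇒anyF (λ j → p (suc j)) i pi)

allF⇒∀ : ∀ {n} (p : Fin n → Bool) → allF p ≡ true → ∀ i → p i ≡ true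
allF⇒∀ p all zero    = proj₁ (∧-true (p zero) all)
allF⇒∀ p all (suc i) = allF⇒∀ (λ j → p (suc j)) (proj₂ (∧-true (p zero) all)) i

∀⇒allF : ∀ {n} (p : Fin n → Bool) → (∀ i → p i ≡ true) → allF p ≡ true
∀⇒allF {zero}  p all = refl
∀⇒allF {suc n} p all = cong₂ _∧_ (all zero) (∀⇒allF (λ j → p (suc j)) (λ i → all (suc i)))

getV-outside : ∀ {n} (xs : Vec ℕ n) → getV xs n ≡ 0
getV-outside []       = refl
getV-outside (x ∷ xs) = getV-outside xs

sumL : ∀ {A : Set} → (A → ℤ) → List A → ℤ
sumL f []       = + 0
sumL f (a ∷ as) = f a + sumL f as

module _ {A : Set} where

  sumL-cong : (f g : A → ℤ) (L : List A) → (∀ a → a ∈ L → f a ≡ g a) → sumL f L ≡ sumL g L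
  sumL-cong f g []      eq = refl
  sumL-cong f g (a ∷ L) eq = cong₂ _+_ (eq a (here refl)) (sumL-cong f g L (λ b b∈L → eq b (there b∈L)))

  sumL-zero : (f : A → ℤ) (L : List A) → (∀ a → a ∈ L → f a ≡ + 0) → sumL f L ≡ + 0
  sumL-zero f []      f≡0 = refl
  sumL-zero f (a ∷ L) f≡0 rewrite f≡0 a (here refl) =
    trans (ℤP.+-identityˡ _) (sumL-zero f L (λ b b∈L → f≡0 b (there b∈L)))

  sumL-+ : (f g : A → ℤ) (L : List A) → sumL (λ a → f a + g a) L ≡ sumL f L + sumL g L
  sumL-+ f g []      = refl
  sumL-+ f g (a ∷ L) rewrite sumL-+ f g L = interchange (f a) (g a) (sumL f L) (sumL g L)
    where
    interchange : ∀ a b c d → a + b + (c + d) ≡ a + c + (b + d)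
    interchange = solve-∀

  sumL-*ˡ : ∀ c (f : A → ℤ) (L : List A) → sumL (λ a → c * f a) L ≡ c * sumL f L
  sumL-*ˡ c f []      = sym (ℤP.*-zeroʳ c)
  sumL-*ˡ c f (a ∷ L) rewrite sumL-*ˡ c f L = sym (ℤP.*-distribˡ-+ c (f a) _)

  sumL-indicator : (p : A → Bool) (c : ℤ) (L : List A) → sumL (λ a → if p a then c else + 0) L ≡ + countL p L * c
  sumL-indicator p c []      = refl
  sumL-indicator p c (a ∷ L) rewrite sumL-indicator p c L with p a
  ... | true  = trans (cong (λ b → b + + countL p L * c) (sym (ℤP.*-identityˡ c)))
                      (sym (ℤP.*-distribʳ-+ c (+ 1) (+ countL p L)))
  ... | false = ℤP.+-identityˡ _

  countL≡sumL : (p : A → Bool) (L : List A) → + countL p L ≡ sumL (λ a → if p a then + 1 else + 0) L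
  countL≡sumL p L = sym (trans (sumL-indicator p (+ 1) L) (ℤP.*-identityʳ _))

  sumZ-sumL : ∀ {n} (f : Fin n → A → ℤ) (L : List A) →
    sumZ (λ x → sumL (f x) L) ≡ sumL (λ a → sumZ (λ x → f x a)) L
  sumZ-sumL {n} f []      = sumZ-zero {n} _ (λ _ → refl)
  sumZ-sumL {n} f (a ∷ L) =
    trans (sumZ-+ (λ x → f x a) (λ x → sumL (f x) L)) (cong (λ s → sumZ (λ x → f x a) + s) (sumZ-sumL f L))

  countL-cong : (p q : A → Bool) (L : List A) → (∀ a → a ∈ L → p a ≡ q a) → countL p L ≡ countL q L
  countL-cong p q []      eq = refl
  countL-cong p q (a ∷ L) eq =
    cong₂ ℕ._+_ (cong (λ b → if b then 1 else 0) (eq a (here refl))) (countL-cong p q L (λ b b∈L → eq b (there b∈L)))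

  countL-none : (p : A → Bool) (L : List A) → (∀ a → a ∈ L → p a ≡ false) → countL p L ≡ 0
  countL-none p []      none = refl
  countL-none p (a ∷ L) none rewrite none a (here refl) = countL-none p L (λ b b∈L → none b (there b∈L))

  countL-positive : (p : A → Bool) (L : List A) (a : A) → a ∈ L → p a ≡ true → 1 ≤ countL p L
  countL-positive p (a ∷ L) a (here refl) pa rewrite pa = s≤s z≤n
  countL-positive p (b ∷ L) a (there a∈L) pa =
    ℕP.≤-trans (countL-positive p L a a∈L pa) (ℕP.m≤n+m _ (if p b then 1 else 0))

  countL-positive⇒∃ : (p : A → Bool) (L : List A) → 1 ≤ countL p L → ∃ λ a → a ∈ L × p a ≡ true
  countL-positive⇒∃ p (a ∷ L) pos with p a in pa
  ... | true  = a , here refl , pa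
  ... | false with countL-positive⇒∃ p L pos
  ...   | b , b∈L , pb = b , there b∈L , pb

  countL-∧-split : (p q : A → Bool) (L : List A) →
    countL p L ≡ countL (λ a → p a ∧ q a) L ℕ.+ countL (λ a → p a ∧ not (q a)) L
  countL-∧-split p q []      = refl
  countL-∧-split p q (a ∷ L) with p a | q a
  ... | true  | true  = cong suc (countL-∧-split p q L)
  ... | true  | false = trans (cong suc (countL-∧-split p q L)) (sym (ℕP.+-suc _ _))
  ... | false | _     = countL-∧-split p q L

  sumL-squares≡0 : (g : A → ℤ) (L : List A) → sumL (λ a → g a * g a) L ≡ + 0 → ∀ a → a ∈ L → g a ≡ + 0
  sumL-squares≡0 g L total a a∈L = square≡0 (g a) (go L total a∈L)
    where
    nonneg : ∀ L → + 0 ℤ.≤ sumL (λ a → g a * g a) L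
    nonneg []      = ℤ.+≤+ z≤n
    nonneg (b ∷ L) = ℤP.+-mono-≤ (square-nonneg (g b)) (nonneg L)
    go : ∀ L → sumL (λ a → g a * g a) L ≡ + 0 → a ∈ L → g a * g a ≡ + 0
    go (b ∷ L) total (here refl) = proj₁ (nonneg-+≡0 (square-nonneg (g b)) (nonneg L) total)
    go (b ∷ L) total (there a∈L) = go L (proj₂ (nonneg-+≡0 (square-nonneg (g b)) (nonneg L) total)) a∈L

module Layers (G : Graph) (C : Subset (Graph.V G)) where
  open Graph G

  InLayer : ℕ → Fin V → Set
  InLayer i x = atC G C i x ≡ true

  private
    W : ℕ → Fin V → Bool
    W = withinC G C

    hits : ℕ → Fin V → Fin V → Bool
    hits i x c = lookup C c ∧ within G i x c

  withinC-suc : ∀ i x → W i x ≡ true → W (suc i) x ≡ true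
  withinC-suc i x w with anyF⇒∃ (hits i x) w
  ... | c , q with ∧-true (lookup C c) q
  ...   | c∈C , xc = ∃⇒anyF (hits (suc i) x) c (cong₂ _∧_ c∈C (cong (_∨ anyF (λ z → adj x z ∧ within G i z c)) xc))

  withinC-neighbour : ∀ i x z → adj x z ≡ true → W i z ≡ true → W (suc i) x ≡ true
  withinC-neighbour i x z xz w with anyF⇒∃ (hits i z) w
  ... | c , q with ∧-true (lookup C c) q
  ...   | c∈C , zc = ∃⇒anyF (hits (suc i) x) c (cong₂ _∧_ c∈C
                       (∨-introʳ (within G i x c) (∃⇒anyF (λ w → adj x w ∧ within G i w c) z (cong₂ _∧_ xz zc))))

  withinC-suc⁻¹ : ∀ i x → W (suc i) x ≡ true → W i x ≡ true ⊎ ∃ λ z → adj x z ≡ true × W i z ≡ true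
  withinC-suc⁻¹ i x w with anyF⇒∃ (hits (suc i) x) w
  ... | c , q with ∧-true (lookup C c) q
  ...   | c∈C , xc with ∨-true (within G i x c) xc
  ...     | inj₁ xc′ = inj₁ (∃⇒anyF (hits i x) c (cong₂ _∧_ c∈C xc′))
  ...     | inj₂ zc with anyF⇒∃ (λ z → adj x z ∧ within G i z c) zc
  ...       | z , r with ∧-true (adj x z) r
  ...         | xz , zc′ = inj₂ (z , xz , ∃⇒anyF (hits i z) c (cong₂ _∧_ c∈C zc′))

  withinC-mono : ∀ {i j} x → i ≤ j → W i x ≡ true → W j x ≡ true
  withinC-mono x i≤j = go (ℕP.≤⇒≤′ i≤j)
    where
    go : ∀ {i j} → i ℕ.≤′ j → W i x ≡ true → W j x ≡ true
    go ℕ.≤′-refl          w = w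
    go (ℕ.≤′-step {n} le) w = withinC-suc n x (go le w)

  InLayer⇒withinC : ∀ i x → InLayer i x → W i x ≡ true
  InLayer⇒withinC zero    x xi = xi
  InLayer⇒withinC (suc i) x xi = proj₁ (∧-true (W (suc i) x) xi)

  InLayer⇒¬withinC : ∀ i x → InLayer (suc i) x → W i x ≡ false
  InLayer⇒¬withinC i x xi = not-true (proj₂ (∧-true (W (suc i) x) xi))

  withinC⇒layer≤ : ∀ n j x → W n x ≡ true → InLayer j x → j ≤ n
  withinC⇒layer≤ n zero    x w xj = z≤n
  withinC⇒layer≤ n (suc j) x w xj with suc j ℕP.≤? n
  ... | yes le = le
  ... | no  gt = contradiction (InLayer⇒¬withinC j x xj)
                   (true⇒≢false (withinC-mono x (ℕP.≤-pred (ℕP.≰⇒> gt)) w))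

  layer-unique : ∀ i j x → InLayer i x → InLayer j x → i ≡ j
  layer-unique i j x xi xj =
    ℕP.≤-antisym (withinC⇒layer≤ j i x (InLayer⇒withinC j x xj) xi) (withinC⇒layer≤ i j x (InLayer⇒withinC i x xi) xj)

  ¬InLayer : ∀ i j x → InLayer j x → i ≢ j → atC G C i x ≡ false
  ¬InLayer i j x xj i≢j = ¬-not (λ xi → i≢j (layer-unique i j x xi xj))

  layer-exists : ∀ n x → W n x ≡ true → ∃ λ j → j ≤ n × InLayer j x
  layer-exists zero    x w = zero , z≤n , w
  layer-exists (suc n) x w with W n x in wn
  ... | true  = let (j , j≤n , xj) = layer-exists n x wn in j , ℕP.m≤n⇒m≤1+n j≤n , xj
  ... | false = suc n , ℕP.≤-refl , cong₂ _∧_ w (cong not wn)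

  neighbour-layer≤ : ∀ i j x z → adj x z ≡ true → InLayer i x → InLayer j z → j ≤ suc i
  neighbour-layer≤ i j x z xz xi zj =
    withinC⇒layer≤ (suc i) j z (withinC-neighbour i z x (trans (adj-sym z x) xz) (InLayer⇒withinC i x xi)) zj

  down-neighbour : ∀ i x → InLayer (suc i) x → ∃ λ z → adj x z ≡ true × InLayer i z
  down-neighbour i x xi with withinC-suc⁻¹ i x (InLayer⇒withinC (suc i) x xi)
  ... | inj₁ w = contradiction (InLayer⇒¬withinC i x xi) (true⇒≢false w)
  ... | inj₂ (z , xz , w) with layer-exists i z w
  ...   | j , j≤i , zj = z , xz , subst (λ l → InLayer l z) (ℕP.≤-antisym j≤i (ℕP.≤-pred i+1≤j+1)) zj
    where
    i+1≤j+1 : suc i ≤ suc j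
    i+1≤j+1 = neighbour-layer≤ j (suc i) z x (trans (adj-sym z x) xz) zj xi

  layer-nonempty-below : ∀ j → (∃ λ x → InLayer j x) → ∀ i → i ≤ j → ∃ λ x → InLayer i x
  layer-nonempty-below j xj i i≤j = go (ℕP.≤⇒≤′ i≤j) xj
    where
    go : ∀ {j} → i ℕ.≤′ j → (∃ λ x → InLayer j x) → ∃ λ x → InLayer i x
    go ℕ.≤′-refl          xj       = xj
    go (ℕ.≤′-step {n} le) (x , xj) = go le (let (z , _ , zj) = down-neighbour n x xj in z , zj)

minEigenvalue-≤ : ∀ (G : Graph) {θ} → IsMinEigenvalue G θ →
  ∀ (f : Fin (Graph.V G) → ℤ) t x₀ → (∀ x → A· G f x ≡ t * f x) → f x₀ ≢ + 0 → θ ℤ.≤ t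
minEigenvalue-≤ G {θ} (_ , psd) f t x₀ eigen fx₀≢0 =
  ℤP.*-cancelʳ-≤-pos θ t ∑f² {{ℤ.positive ∑f²>0}} θ∑f²≤t∑f²
  where
  ∑f² : ℤ
  ∑f² = sumZ (λ x → f x * f x)
  θ∑f²≤t∑f² : θ * ∑f² ℤ.≤ t * ∑f²
  θ∑f²≤t∑f² = subst (θ * ∑f² ℤ.≤_) fAf≡t∑f² (psd f)
    where
    swap : ∀ a t → a * (t * a) ≡ t * (a * a)
    swap = solve-∀
    fAf≡t∑f² : sumZ (λ x → f x * A· G f x) ≡ t * ∑f²
    fAf≡t∑f² = trans (sumZ-cong _ _ (λ x → trans (cong (f x *_) (eigen x)) (swap (f x) t))) (sumZ-*ˡ t (λ x → f x * f x))
  ∑f²>0 : + 0 ℤ.< ∑f²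
  ∑f²>0 = ℤP.<-≤-trans (ℤP.≤∧≢⇒< (square-nonneg (f x₀)) (λ eq → fx₀≢0 (square≡0 (f x₀) (sym eq))))
                       (sumZ-≥-term _ (λ x → square-nonneg (f x)) x₀)

module LayerFunctions (G : Graph) (C : Subset (Graph.V G)) {ρ : ℕ} {al : Vec ℕ (suc ρ)} {be ga : Vec ℕ ρ}
                      (crc : IsCRC G C ρ al be ga) where
  open Graph G
  open Layers G C
  open IsCRC crc

  layer : Fin V → ℕ
  layer x = proj₁ (layer-exists ρ x (covers x))

  InLayer-layer : ∀ x → InLayer (layer x) x
  InLayer-layer x = proj₂ (proj₂ (layer-exists ρ x (covers x)))

  InLayer⇒≤ρ : ∀ i x → InLayer i x → i ≤ ρ
  InLayer⇒≤ρ i x xi = withinC⇒layer≤ ρ i x (covers x) xi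

  lift : (ℕ → ℤ) → Fin V → ℤ
  lift w x = w (layer x)

  lift-InLayer : ∀ w i x → InLayer i x → lift w x ≡ w i
  lift-InLayer w i x xi = cong w (layer-unique _ i x (InLayer-layer x) xi)

  neighbour-layer : ∀ i l x y → adj x y ≡ true → InLayer i x → InLayer l y → suc l ≡ i ⊎ l ≡ i ⊎ l ≡ suc i
  neighbour-layer i l x y xy xi yl with ℕP.<-cmp l i
  ... | tri≈ _ l≡i _ = inj₂ (inj₁ l≡i)
  ... | tri> _ _ l>i = inj₂ (inj₂ (ℕP.≤-antisym (neighbour-layer≤ i l x y xy xi yl) l>i))
  ... | tri< l<i _ _ = inj₁ (ℕP.≤-antisym l<i (neighbour-layer≤ l i y x (trans (adj-sym y x) xy) yl xi))

  neighbourIn : ℕ → Fin V → Fin V → Bool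
  neighbourIn j x y = adj x y ∧ atC G C j y

  toLayer : (ℕ → ℤ) → ℕ → Fin V → Fin V → ℤ
  toLayer w j x y = if neighbourIn j x y then w j else + 0

  toLayer-nonadjacent : ∀ w j x y → adj x y ≡ false → toLayer w j x y ≡ + 0
  toLayer-nonadjacent w j x y xy rewrite xy = refl

  toLayer-other : ∀ w j l x y → InLayer l y → l ≢ j → toLayer w j x y ≡ + 0
  toLayer-other w j l x y yl l≢j rewrite ¬InLayer j l y yl (λ j≡l → l≢j (sym j≡l)) | ∧-zeroʳ (adj x y) = refl

  toLayer-hit : ∀ w j x y → adj x y ≡ true → InLayer j y → toLayer w j x y ≡ w j
  toLayer-hit w j x y xy yj rewrite xy | yj = refl

  toLowerLayer : (ℕ → ℤ) → ℕ → Fin V → Fin V → ℤ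
  toLowerLayer w zero    x y = + 0
  toLowerLayer w (suc j) x y = toLayer w j x y

  toLowerLayer-nonadjacent : ∀ w i x y → adj x y ≡ false → toLowerLayer w i x y ≡ + 0
  toLowerLayer-nonadjacent w zero    x y xy = refl
  toLowerLayer-nonadjacent w (suc j) x y xy = toLayer-nonadjacent w j x y xy

  toLowerLayer-other : ∀ w i l x y → InLayer l y → suc l ≢ i → toLowerLayer w i x y ≡ + 0
  toLowerLayer-other w zero    l x y yl _   = refl
  toLowerLayer-other w (suc j) l x y yl l≢j = toLayer-other w j l x y yl (λ l≡j → l≢j (cong suc l≡j))

  neighbour-decomposition : ∀ w i x y → InLayer i x →
    (if adj x y then lift w y else + 0) ≡ toLowerLayer w i x y + toLayer w i x y + toLayer w (suc i) x y
  neighbour-decomposition w i x y xi with Bool-dichotomy (adj x y)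
  ... | inj₂ xy = trans (if-false xy) (sym (cong₂ _+_ (cong₂ _+_ (toLowerLayer-nonadjacent w i x y xy)
                    (toLayer-nonadjacent w i x y xy)) (toLayer-nonadjacent w (suc i) x y xy)))
  ... | inj₁ xy = trans (if-true xy)
                    (at-layer i (layer y) (InLayer-layer y) (neighbour-layer i (layer y) x y xy xi (InLayer-layer y)))
    where
    at-layer : ∀ i l → InLayer l y → suc l ≡ i ⊎ l ≡ i ⊎ l ≡ suc i →
               w l ≡ toLowerLayer w i x y + toLayer w i x y + toLayer w (suc i) x y
    at-layer .(suc l) l yl (inj₁ refl) = sym (begin
      toLayer w l x y + toLayer w (suc l) x y + toLayer w (suc (suc l)) x y
        ≡⟨ cong₂ _+_ (cong₂ _+_ (toLayer-hit w l x y xy yl) (toLayer-other w (suc l) l x y yl (≢-sym ℕP.1+n≢n)))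
                     (toLayer-other w (suc (suc l)) l x y yl (ℕP.m≢1+n+m l)) ⟩
      w l + + 0 + + 0 ≡⟨ trans (ℤP.+-identityʳ _) (ℤP.+-identityʳ _) ⟩
      w l ∎)
      where open ≡-Reasoning
    at-layer i .i yl (inj₂ (inj₁ refl)) = sym (begin
      toLowerLayer w i x y + toLayer w i x y + toLayer w (suc i) x y
        ≡⟨ cong₂ _+_ (cong₂ _+_ (toLowerLayer-other w i i x y yl ℕP.1+n≢n) (toLayer-hit w i x y xy yl))
                     (toLayer-other w (suc i) i x y yl (≢-sym ℕP.1+n≢n)) ⟩
      + 0 + w i + + 0 ≡⟨ trans (ℤP.+-identityʳ _) (ℤP.+-identityˡ _) ⟩
      w i ∎)
      where open ≡-Reasoning
    at-layer i .(suc i) yl (inj₂ (inj₂ refl)) = sym (begin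
      toLowerLayer w i x y + toLayer w i x y + toLayer w (suc i) x y
        ≡⟨ cong₂ _+_ (cong₂ _+_ (toLowerLayer-other w i (suc i) x y yl (≢-sym (ℕP.m≢1+n+m i)))
                                (toLayer-other w i (suc i) x y yl ℕP.1+n≢n))
                     (toLayer-hit w (suc i) x y xy yl) ⟩
      + 0 + + 0 + w (suc i) ≡⟨ ℤP.+-identityˡ _ ⟩
      w (suc i) ∎)
      where open ≡-Reasoning

  countUp : ∀ i x → InLayer i x → countF (neighbourIn (suc i) x) ≡ getV be i
  countUp i x xi with suc i ℕP.≤? ρ
  ... | yes i<ρ = β-const i i<ρ x xi
  ... | no  i≮ρ with ℕP.≤-antisym (InLayer⇒≤ρ i x xi) (ℕP.≤-pred (ℕP.≰⇒> i≮ρ))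
  ...   | refl = trans (countF-none _ nothing-above) (sym (getV-outside be))
    where
    nothing-above : ∀ y → neighbourIn (suc ρ) x y ≡ false
    nothing-above y with atC G C (suc ρ) y in yρ+1
    ... | true  = contradiction (InLayer⇒≤ρ (suc ρ) y yρ+1) (ℕP.<-irrefl refl)
    ... | false = ∧-zeroʳ (adj x y)

  neighbourSum-split : ∀ w i x → InLayer i x →
    A· G (lift w) x ≡ sumZ (toLowerLayer w i x) + + getV al i * w i + + getV be i * w (suc i)
  neighbourSum-split w i x xi = begin
    A· G (lift w) x
      ≡⟨ sumZ-cong _ _ (λ y → neighbour-decomposition w i x y xi) ⟩
    sumZ (λ y → toLowerLayer w i x y + toLayer w i x y + toLayer w (suc i) x y)
      ≡⟨ trans (sumZ-+ (λ y → toLowerLayer w i x y + toLayer w i x y) (toLayer w (suc i) x))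
               (cong (_+ sumZ (toLayer w (suc i) x)) (sumZ-+ (toLowerLayer w i x) (toLayer w i x))) ⟩
    sumZ (toLowerLayer w i x) + sumZ (toLayer w i x) + sumZ (toLayer w (suc i) x)
      ≡⟨ cong₂ (λ a b → sumZ (toLowerLayer w i x) + a + b)
           (trans (sumZ-indicator (neighbourIn i x) (w i)) (cong (λ n → + n * w i) (α-const i (InLayer⇒≤ρ i x xi) x xi)))
           (trans (sumZ-indicator (neighbourIn (suc i) x) (w (suc i))) (cong (λ n → + n * w (suc i)) (countUp i x xi))) ⟩
    sumZ (toLowerLayer w i x) + + getV al i * w i + + getV be i * w (suc i) ∎
    where open ≡-Reasoning

  neighbourSum-lift : ∀ w i x → InLayer i x → A· G (lift w) x ≡ triRow al be ga w i
  neighbourSum-lift w zero    x xi =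
    trans (neighbourSum-split w zero x xi)
          (cong (λ s → s + + getV al 0 * w 0 + + getV be 0 * w 1) (sumZ-zero (toLowerLayer w zero x) (λ _ → refl)))
  neighbourSum-lift w (suc j) x xi =
    trans (neighbourSum-split w (suc j) x xi)
          (cong (λ s → s + + getV al (suc j) * w (suc j) + + getV be (suc j) * w (suc (suc j)))
                (trans (sumZ-indicator (neighbourIn j x) (w j))
                                          (cong (λ n → + n * w j) (γ-const j (InLayer⇒≤ρ (suc j) x xi) x xi))))

  lift-eigenvector : ∀ w t → (∀ i → i ≤ ρ → triRow al be ga w i ≡ t * w i) → ∀ x → A· G (lift w) x ≡ t * lift w x
  lift-eigenvector w t rows x =
    trans (neighbourSum-lift w (layer x) x (InLayer-layer x)) (rows (layer x) (InLayer⇒≤ρ _ x (InLayer-layer x)))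

module IntersectionMatrix (k : ℕ) {ρ : ℕ} (be ga : Vec ℕ ρ) where

  β : ℕ → ℕ
  β = getV be

  -- γ i is the paper's γ_i: ga lists γ_1, …, γ_ρ.
  γ : ℕ → ℕ
  γ zero    = 0
  γ (suc j) = getV ga j

  -- The diagonal of the intersection matrix is not an argument of b, so it is recovered from the
  -- valency as k − β_i − γ_i.
  α : ℕ → ℤ
  α i = + k - + β i - + γ i

  -- charPoly t i = det (t I − M) for the leading i × i block M of the intersection matrix.
  charPoly : ℤ → ℕ → ℤ
  charPoly t zero          = + 1
  charPoly t (suc zero)    = t - α 0
  charPoly t (suc (suc j)) = (t - α (suc j)) * charPoly t (suc j) - + γ (suc j) * + β j * charPoly t j

  βProduct : ℕ → ℕ
  βProduct zero    = 1
  βProduct (suc i) = βProduct i ℕ.* β i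

  βProduct-suc : ∀ i → + βProduct (suc i) ≡ + βProduct i * + β i
  βProduct-suc i = ℤP.pos-* (βProduct i) (β i)

  βRange : ℕ → ℕ → ℕ
  βRange zero    i = 1
  βRange (suc n) i = β i ℕ.* βRange n (suc i)

  βSuffix : ℕ → ℕ
  βSuffix i = βRange (ρ ∸ i) i

  βSuffix-step : ∀ i → i < ρ → βSuffix i ≡ β i ℕ.* βSuffix (suc i)
  βSuffix-step i i<ρ rewrite ℕP.+-∸-assoc 1 i<ρ = refl

  module _ (β-positive : ∀ i → i < ρ → 1 ≤ β i) where

    βProduct≢0 : ∀ i → i ≤ ρ → + βProduct i ≢ + 0
    βProduct≢0 zero    _   ()
    βProduct≢0 (suc i) i<ρ eq with ℕP.m*n≡0⇒m≡0∨n≡0 (βProduct i) (ℤP.+-injective eq)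
    ... | inj₁ Bi≡0 = βProduct≢0 i (ℕP.<⇒≤ i<ρ) (cong +_ Bi≡0)
    ... | inj₂ βi≡0 = ℕP.<-irrefl (sym βi≡0) (β-positive i i<ρ)

    βRange≢0 : ∀ n i → i ℕ.+ n ≤ ρ → βRange n i ≢ 0
    βRange≢0 zero    i _       ()
    βRange≢0 (suc n) i i+n+1≤ρ eq with ℕP.m*n≡0⇒m≡0∨n≡0 (β i) eq
    ... | inj₁ βi≡0 = ℕP.<-irrefl (sym βi≡0) (β-positive i (ℕP.<-≤-trans (ℕP.m<m+n i (s≤s z≤n)) i+n+1≤ρ))
    ... | inj₂ rest = βRange≢0 n (suc i) (subst (_≤ ρ) (ℕP.+-suc i n) i+n+1≤ρ) rest

  module WithDiagonal (al : Vec ℕ (suc ρ)) (α≡ : ∀ i → i ≤ ρ → + getV al i ≡ α i) where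

    module Eigenvector (t : ℤ) (u : ℕ → ℤ) (rows : ∀ i → i ≤ ρ → triRow al be ga u i ≡ t * u i) where

      private
        row : ∀ i → i ≤ ρ → + γ i * u (ℕ.pred i) + α i * u i + + β i * u (suc i) ≡ t * u i
        row zero    0≤ρ = subst (λ a → + 0 + a * u 0 + + β 0 * u 1 ≡ t * u 0) (α≡ 0 0≤ρ) (rows 0 0≤ρ)
        row (suc j) j<ρ = subst (λ a → + γ (suc j) * u j + a * u (suc j) + + β (suc j) * u (suc (suc j)) ≡ t * u (suc j))
                                (α≡ (suc j) j<ρ) (rows (suc j) j<ρ)

        next : ∀ i → i ≤ ρ → + β i * u (suc i) ≡ (t - α i) * u i - + γ i * u (ℕ.pred i)
        next i i≤ρ = isolate (+ γ i * u (ℕ.pred i)) (α i) (+ β i * u (suc i)) t (u i) (row i i≤ρ)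
          where
          isolate : ∀ x a z t v → x + a * v + z ≡ t * v → z ≡ (t - a) * v - x
          isolate x a z t v eq = begin
            z                           ≡⟨ cancel x a z v ⟩
            x + a * v + z - a * v - x   ≡⟨ cong (λ s → s - a * v - x) eq ⟩
            t * v - a * v - x           ≡⟨ factor t a v x ⟩
            (t - a) * v - x             ∎
            where
            open ≡-Reasoning
            cancel : ∀ x a z v → z ≡ x + a * v + z - a * v - x
            cancel = solve-∀
            factor : ∀ t a v x → t * v - a * v - x ≡ (t - a) * v - x
            factor = solve-∀

      eigenvector-scaled : ∀ i → i ≤ suc ρ → + βProduct i * u i ≡ u 0 * charPoly t i
      eigenvector-scaled zero          _ = base (u 0)
        where
        base : ∀ a → + 1 * a ≡ a * + 1
        base = solve-∀
      eigenvector-scaled (suc zero)    _ = begin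
        + βProduct 1 * u 1        ≡⟨ cong (_* u 1) (βProduct-suc 0) ⟩
        + 1 * + β 0 * u 1         ≡⟨ trans (ℤP.*-assoc (+ 1) (+ β 0) (u 1)) (ℤP.*-identityˡ _) ⟩
        + β 0 * u 1               ≡⟨ next 0 z≤n ⟩
        (t - α 0) * u 0 - + 0 * u 0 ≡⟨ step (t - α 0) (u 0) ⟩
        u 0 * (t - α 0)           ∎
        where
        open ≡-Reasoning
        step : ∀ a v → a * v - + 0 * v ≡ v * a
        step = solve-∀
      eigenvector-scaled (suc (suc j)) j+2≤ρ+1 = begin
        + βProduct (suc (suc j)) * u (suc (suc j))
          ≡⟨ trans (cong (_* u (suc (suc j))) (βProduct-suc (suc j)))
                   (ℤP.*-assoc (+ βProduct (suc j)) (+ β (suc j)) (u (suc (suc j)))) ⟩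
        + βProduct (suc j) * (+ β (suc j) * u (suc (suc j)))
          ≡⟨ cong (+ βProduct (suc j) *_) (next (suc j) (ℕP.≤-pred j+2≤ρ+1)) ⟩
        + βProduct (suc j) * ((t - α (suc j)) * u (suc j) - + γ (suc j) * u j)
          ≡⟨ expand _ (+ βProduct j) (+ β j) (t - α (suc j)) (u (suc j)) (+ γ (suc j)) (u j) (βProduct-suc j) ⟩
        (t - α (suc j)) * (+ βProduct (suc j) * u (suc j)) - + γ (suc j) * + β j * (+ βProduct j * u j)
          ≡⟨ cong₂ (λ p q → (t - α (suc j)) * p - + γ (suc j) * + β j * q)
                   (eigenvector-scaled (suc j) (ℕP.m≤n⇒m≤1+n (ℕP.≤-pred j+2≤ρ+1)))
                   (eigenvector-scaled j (ℕP.m≤n⇒m≤1+n (ℕP.<⇒≤ (ℕP.≤-pred j+2≤ρ+1)))) ⟩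
        (t - α (suc j)) * (u 0 * charPoly t (suc j)) - + γ (suc j) * + β j * (u 0 * charPoly t j)
          ≡⟨ collect (t - α (suc j)) (u 0) (charPoly t (suc j)) (+ γ (suc j) * + β j) (charPoly t j) ⟩
        u 0 * charPoly t (suc (suc j)) ∎
        where
        open ≡-Reasoning
        expand : ∀ B Bj b a v g w → B ≡ Bj * b → B * (a * v - g * w) ≡ a * (B * v) - g * b * (Bj * w)
        expand B Bj b a v g w B≡Bjb rewrite B≡Bjb = ring Bj b a v g w
          where
          ring : ∀ Bj b a v g w → Bj * b * (a * v - g * w) ≡ a * (Bj * b * v) - g * b * (Bj * w)
          ring = solve-∀
        collect : ∀ a u0 p c q → a * (u0 * p) - c * (u0 * q) ≡ u0 * (a * p - c * q)
        collect = solve-∀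

      eigenvector⇒charPoly-root : u 0 ≢ + 0 → charPoly t (suc ρ) ≡ + 0
      eigenvector⇒charPoly-root u0≢0 = *≡0-cancelˡ (u 0) u0≢0 (trans (sym (eigenvector-scaled (suc ρ) ℕP.≤-refl)) top≡0)
        where
        top≡0 : + βProduct (suc ρ) * u (suc ρ) ≡ + 0
        top≡0 rewrite getV-outside be | ℕP.*-zeroʳ (βProduct ρ) = refl

      eigenvector-head≢0 : (∀ i → i < ρ → 1 ≤ β i) → ∀ i → i ≤ ρ → u i ≢ + 0 → u 0 ≢ + 0
      eigenvector-head≢0 β-positive i i≤ρ ui≢0 u0≡0 =
        ui≢0 (*≡0-cancelˡ (+ βProduct i) (βProduct≢0 β-positive i i≤ρ)
               (trans (eigenvector-scaled i (ℕP.m≤n⇒m≤1+n i≤ρ)) (cong (_* charPoly t i) u0≡0)))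

    module Root (t : ℤ) (root : charPoly t (suc ρ) ≡ + 0) where

      rootVector : ℕ → ℤ
      rootVector i = charPoly t i * + βSuffix i

      private
        v p : ℕ → ℤ
        v = rootVector
        p = charPoly t
        E : ℕ → ℕ
        E = βSuffix

        β-next : ∀ i → i ≤ ρ → + β i * v (suc i) ≡ p (suc i) * + E i
        β-next i i≤ρ with i ℕP.≟ ρ
        ... | yes refl rewrite getV-outside be | root = refl
        ... | no  i≢ρ rewrite βSuffix-step i (ℕP.≤∧≢⇒< i≤ρ i≢ρ) =
          trans (swap (+ β i) (p (suc i)) (+ E (suc i))) (cong (p (suc i) *_) (sym (ℤP.pos-* (β i) (E (suc i)))))
          where
          swap : ∀ a b c → a * (b * c) ≡ b * (a * c)
          swap = solve-∀

        v-split : ∀ j → j < ρ → v j ≡ p j * + β j * + E (suc j)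
        v-split j j<ρ rewrite βSuffix-step j j<ρ =
          trans (cong (p j *_) (ℤP.pos-* (β j) (E (suc j)))) (sym (ℤP.*-assoc (p j) (+ β j) (+ E (suc j))))

      rootVector-head≢0 : (∀ i → i < ρ → 1 ≤ β i) → rootVector 0 ≢ + 0
      rootVector-head≢0 β-positive eq =
        βRange≢0 β-positive ρ 0 ℕP.≤-refl (ℤP.+-injective (trans (sym (ℤP.*-identityˡ (+ βSuffix 0))) eq))

      rootVector-rows : ∀ i → i ≤ ρ → triRow al be ga rootVector i ≡ t * rootVector i
      rootVector-rows zero    0≤ρ = begin
        + 0 + + getV al 0 * v 0 + + β 0 * v 1
          ≡⟨ cong₂ (λ a b → + 0 + a * v 0 + b) (α≡ 0 0≤ρ) (β-next 0 0≤ρ) ⟩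
        + 0 + α 0 * (+ 1 * + E 0) + (t - α 0) * + E 0
          ≡⟨ ring (α 0) (+ E 0) t ⟩
        t * v 0 ∎
        where
        open ≡-Reasoning
        ring : ∀ a e t → + 0 + a * (+ 1 * e) + (t - a) * e ≡ t * (+ 1 * e)
        ring = solve-∀
      rootVector-rows (suc j) j<ρ = begin
        + γ (suc j) * v j + + getV al (suc j) * v (suc j) + + β (suc j) * v (suc (suc j))
          ≡⟨ cong₂ (λ a b → + γ (suc j) * v j + a * v (suc j) + b) (α≡ (suc j) j<ρ) (β-next (suc j) j<ρ) ⟩
        + γ (suc j) * v j + α (suc j) * v (suc j) + p (suc (suc j)) * + E (suc j)
          ≡⟨ cong (λ a → + γ (suc j) * a + α (suc j) * v (suc j) + p (suc (suc j)) * + E (suc j)) (v-split j j<ρ) ⟩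
        + γ (suc j) * (p j * + β j * + E (suc j)) + α (suc j) * (p (suc j) * + E (suc j))
          + ((t - α (suc j)) * p (suc j) - + γ (suc j) * + β j * p j) * + E (suc j)
          ≡⟨ ring (+ γ (suc j)) (p j) (+ β j) (+ E (suc j)) (α (suc j)) (p (suc j)) t ⟩
        t * v (suc j) ∎
        where
        open ≡-Reasoning
        ring : ∀ g q b e a q′ t → g * (q * b * e) + a * (q′ * e) + ((t - a) * q′ - g * b * q) * e ≡ t * (q′ * e)
        ring = solve-∀

module GeometricGraph (G : Graph) {k : ℕ} {θ : ℤ} {𝒦 : List (Subset (Graph.V G))}
                      (regular : ∀ x → countF (Graph.adj G x) ≡ k) (k≢0 : k ≢ 0)
                      (geometric : IsGeometric G k θ 𝒦) where
  open Graph G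

  ∈𝒦⇒delsarte : ∀ {K} → K ∈ 𝒦 → IsDelsarteClique G k θ K
  ∈𝒦⇒delsarte K∈𝒦 = All.lookup (proj₁ (proj₂ geometric)) K∈𝒦

  cliquesThrough : Fin V → ℕ
  cliquesThrough x = countL (λ K → lookup K x) 𝒦

  cliquesThrough-edge : ∀ x y → adj x y ≡ true → ∃ λ K → K ∈ 𝒦 × (lookup K x ∧ lookup K y) ≡ true
  cliquesThrough-edge x y xy =
    countL-positive⇒∃ (λ K → lookup K x ∧ lookup K y) 𝒦 (ℕP.≤-reflexive (sym (proj₂ (proj₂ geometric) x y xy)))

  commonCliques-distinct : ∀ x y → x ≢ y → + countL (λ K → lookup K x ∧ lookup K y) 𝒦 ≡ (if adj x y then + 1 else + 0)
  commonCliques-distinct x y x≢y with adj x y in xy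
  ... | true  = cong +_ (proj₂ (proj₂ geometric) x y xy)
  ... | false = cong +_ (countL-none _ 𝒦 (λ K K∈𝒦 → ¬-not (λ both →
                  let (Kx , Ky) = ∧-true (lookup K x) both in
                  true⇒≢false (proj₁ (∈𝒦⇒delsarte K∈𝒦) x y Kx Ky x≢y) xy)))

  commonCliques : ∀ x y → + countL (λ K → lookup K x ∧ lookup K y) 𝒦
                          ≡ (if adj x y then + 1 else + 0) + (if ⌊ x ≟ᶠ y ⌋ then + cliquesThrough x else + 0)
  commonCliques x y with x ≟ᶠ y
  ... | yes refl rewrite adj-irrefl x = cong +_ (countL-cong _ _ 𝒦 (λ K _ → ∧-idem (lookup K x)))
  ... | no  x≢y  = trans (commonCliques-distinct x y x≢y) (sym (ℤP.+-identityʳ _))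

  θ≡-cliquesThrough : ∀ x → θ ≡ - + cliquesThrough x
  θ≡-cliquesThrough x = ℤP.*-cancelˡ-≡ (+ k) θ (- + c) {{ℤ.≢-nonZero (k≢0 ∘ ℤP.+-injective)}}
                          (solve-for-θ θ (+ k) (+ c) (trans (cong (θ *_) (sym sizes≡k+c)) θ*sizes))
    where
    c : ℕ
    c = cliquesThrough x
    sizes : ℤ
    sizes = sumL (λ K → if lookup K x then + countF (lookup K) else + 0) 𝒦

    sizes≡k+c : sizes ≡ + k + + c
    sizes≡k+c = begin
      sizes
        ≡⟨ sumL-cong _ _ 𝒦 (λ K _ → size-as-sum K) ⟩
      sumL (λ K → sumZ (λ y → if lookup K x ∧ lookup K y then + 1 else + 0)) 𝒦
        ≡⟨ sym (sumZ-sumL (λ y K → if lookup K x ∧ lookup K y then + 1 else + 0) 𝒦) ⟩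
      sumZ (λ y → sumL (λ K → if lookup K x ∧ lookup K y then + 1 else + 0) 𝒦)
        ≡⟨ sumZ-cong _ _ (λ y → trans (sym (countL≡sumL _ 𝒦)) (commonCliques x y)) ⟩
      sumZ (λ y → (if adj x y then + 1 else + 0) + (if ⌊ x ≟ᶠ y ⌋ then + c else + 0))
        ≡⟨ sumZ-+ (λ y → if adj x y then + 1 else + 0) (λ y → if ⌊ x ≟ᶠ y ⌋ then + c else + 0) ⟩
      sumZ (λ y → if adj x y then + 1 else + 0) + sumZ (λ y → if ⌊ x ≟ᶠ y ⌋ then + c else + 0)
        ≡⟨ cong₂ _+_ (trans (sym (countF≡sumZ (adj x))) (cong +_ (regular x))) (sumZ-diagonal x (λ _ → + c)) ⟩
      + k + + c ∎
      where
      open ≡-Reasoning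
      size-as-sum : ∀ K → (if lookup K x then + countF (lookup K) else + 0)
                          ≡ sumZ (λ y → if lookup K x ∧ lookup K y then + 1 else + 0)
      size-as-sum K with lookup K x
      ... | true  = countF≡sumZ (lookup K)
      ... | false = sym (sumZ-zero {V} _ (λ _ → refl))

    θ*sizes : θ * sizes ≡ + c * (θ - + k)
    θ*sizes = trans (sym (sumL-*ˡ θ _ 𝒦)) (trans (sumL-cong _ _ 𝒦 delsarte) (sumL-indicator _ _ 𝒦))
      where
      delsarte : ∀ K → K ∈ 𝒦 → θ * (if lookup K x then + countF (lookup K) else + 0) ≡ (if lookup K x then θ - + k else + 0)
      delsarte K K∈𝒦 with lookup K x
      ... | true  = trans (ℤP.*-comm θ _) (proj₂ (∈𝒦⇒delsarte K∈𝒦))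
      ... | false = ℤP.*-zeroʳ θ

    solve-for-θ : ∀ t k c → t * (k + c) ≡ c * (t - k) → k * t ≡ k * (- c)
    solve-for-θ t k c eq = begin
      k * t                      ≡⟨ expand t k c ⟩
      t * (k + c) - c * t        ≡⟨ cong (_- c * t) eq ⟩
      c * (t - k) - c * t        ≡⟨ simplify t k c ⟩
      k * (- c)                  ∎
      where
      open ≡-Reasoning
      expand : ∀ t k c → k * t ≡ t * (k + c) - c * t
      expand = solve-∀
      simplify : ∀ t k c → c * (t - k) - c * t ≡ k * (- c)
      simplify = solve-∀

  cliqueSum : (Fin V → ℤ) → Subset V → ℤ
  cliqueSum f K = sumZ (λ y → if lookup K y then f y else + 0)

  module _ (f : Fin V → ℤ) (eigen : ∀ x → A· G f x ≡ θ * f x) where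

    private
      pairTerm : Subset V → Fin V → Fin V → ℤ
      pairTerm K x y = if lookup K x ∧ lookup K y then f x * f y else + 0

      cliqueSum-squared : ∀ K → cliqueSum f K * cliqueSum f K ≡ sumZ (λ x → sumZ (pairTerm K x))
      cliqueSum-squared K =
        trans (sym (sumZ-*ʳ (cliqueSum f K) g))
              (sumZ-cong _ _ (λ x → trans (sym (sumZ-*ˡ (g x) g)) (sumZ-cong _ _ (product x))))
        where
        g : Fin V → ℤ
        g y = if lookup K y then f y else + 0
        product : ∀ x y → g x * g y ≡ pairTerm K x y
        product x y with lookup K x | lookup K y
        ... | true  | true  = refl
        ... | true  | false = ℤP.*-zeroʳ (f x)
        ... | false | _     = refl

      weighted-if : ∀ (b c : Bool) n z → ((if b then + 1 else + 0) + (if c then n else + 0)) * z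
                                        ≡ (if b then z else + 0) + (if c then n * z else + 0)
      weighted-if true  true  n z = ring n z
        where ring : ∀ n z → (+ 1 + n) * z ≡ z + n * z
              ring = solve-∀
      weighted-if true  false n z = trans (ℤP.*-identityˡ z) (sym (ℤP.+-identityʳ z))
      weighted-if false true  n z = trans (cong (_* z) (ℤP.+-identityˡ n)) (sym (ℤP.+-identityˡ (n * z)))
      weighted-if false false n z = refl

      row-vanishes : ∀ x → sumZ (λ y → + countL (λ K → lookup K x ∧ lookup K y) 𝒦 * (f x * f y)) ≡ + 0
      row-vanishes x = begin
        sumZ (λ y → + countL (λ K → lookup K x ∧ lookup K y) 𝒦 * (f x * f y))
          ≡⟨ sumZ-cong _ _ (λ y → trans (cong (_* (f x * f y)) (commonCliques x y))
                                         (weighted-if (adj x y) ⌊ x ≟ᶠ y ⌋ (+ c) (f x * f y))) ⟩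
        sumZ (λ y → (if adj x y then f x * f y else + 0) + (if ⌊ x ≟ᶠ y ⌋ then + c * (f x * f y) else + 0))
          ≡⟨ sumZ-+ (λ y → if adj x y then f x * f y else + 0) (λ y → if ⌊ x ≟ᶠ y ⌋ then + c * (f x * f y) else + 0) ⟩
        sumZ (λ y → if adj x y then f x * f y else + 0) + sumZ (λ y → if ⌊ x ≟ᶠ y ⌋ then + c * (f x * f y) else + 0)
          ≡⟨ cong₂ _+_ (trans (sumZ-cong _ _ pull-fx) (sumZ-*ˡ (f x) (λ y → if adj x y then f y else + 0)))
                       (sumZ-diagonal x (λ y → + c * (f x * f y))) ⟩
        f x * A· G f x + + c * (f x * f x)
          ≡⟨ cong (λ a → f x * a + + c * (f x * f x)) (trans (eigen x) (cong (_* f x) (θ≡-cliquesThrough x))) ⟩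
        f x * (- + c * f x) + + c * (f x * f x)
          ≡⟨ cancel (f x) (+ c) ⟩
        + 0 ∎
        where
        open ≡-Reasoning
        c : ℕ
        c = cliquesThrough x
        pull-fx : ∀ y → (if adj x y then f x * f y else + 0) ≡ f x * (if adj x y then f y else + 0)
        pull-fx y with adj x y
        ... | true  = refl
        ... | false = sym (ℤP.*-zeroʳ (f x))
        cancel : ∀ a m → a * (- m * a) + m * (a * a) ≡ + 0
        cancel = solve-∀

    -- Two distinct vertices share one clique if adjacent and none otherwise, and every vertex lies in
    -- −θ cliques, so Σ_K (cliqueSum f K)² = Σ_x f x ((A f) x − θ f x) = 0.
    cliqueSum-zero : ∀ K → K ∈ 𝒦 → cliqueSum f K ≡ + 0
    cliqueSum-zero = sumL-squares≡0 (cliqueSum f) 𝒦 (begin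
      sumL (λ K → cliqueSum f K * cliqueSum f K) 𝒦
        ≡⟨ sumL-cong _ _ 𝒦 (λ K _ → cliqueSum-squared K) ⟩
      sumL (λ K → sumZ (λ x → sumZ (pairTerm K x))) 𝒦
        ≡⟨ sym (sumZ-sumL (λ x K → sumZ (pairTerm K x)) 𝒦) ⟩
      sumZ (λ x → sumL (λ K → sumZ (pairTerm K x)) 𝒦)
        ≡⟨ sumZ-cong _ _ (λ x → sym (sumZ-sumL (λ y K → pairTerm K x y) 𝒦)) ⟩
      sumZ (λ x → sumZ (λ y → sumL (λ K → pairTerm K x y) 𝒦))
        ≡⟨ sumZ-cong _ _ (λ x → sumZ-cong _ _ (λ y → sumL-indicator (λ K → lookup K x ∧ lookup K y) (f x * f y) 𝒦)) ⟩
      sumZ (λ x → sumZ (λ y → + countL (λ K → lookup K x ∧ lookup K y) 𝒦 * (f x * f y)))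
        ≡⟨ sumZ-zero _ row-vanishes ⟩
      + 0 ∎)
      where open ≡-Reasoning

module _ (G : Graph) where
  open Graph G

  within-refl : ∀ n x → within G n x x ≡ true
  within-refl zero    x = ≟ᶠ-refl x
  within-refl (suc n) x = cong (_∨ anyF (λ z → adj x z ∧ within G n z x)) (within-refl n x)

  within⇒≡⊎neighbour : ∀ n x y → within G n x y ≡ true → x ≡ y ⊎ ∃ λ z → adj x z ≡ true
  within⇒≡⊎neighbour zero    x y w with x ≟ᶠ y
  ... | yes x≡y = inj₁ x≡y
  within⇒≡⊎neighbour (suc n) x y w with ∨-true (within G n x y) w
  ... | inj₁ w′ = within⇒≡⊎neighbour n x y w′
  ... | inj₂ w′ with anyF⇒∃ (λ z → adj x z ∧ within G n z y) w′
  ...   | z , xz = inj₂ (z , proj₁ (∧-true (adj x z) xz))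

  module _ {k d : ℕ} {bs cs : Vec ℕ d} (drg : IsDRG G k d bs cs) (d≥1 : 1 ≤ d) where
    open IsDRG drg

    DRG-edge : ∃₂ λ x z → adj x z ≡ true
    DRG-edge with diameter
    ... | x , y , xy = x , neighbour d≥1 xy
      where
      neighbour : ∀ {n y} → 1 ≤ n → atDist G n x y ≡ true → ∃ λ z → adj x z ≡ true
      neighbour {suc n} {y} _ xy with ∧-true (within G (suc n) x y) xy
      ... | w , ¬w with within⇒≡⊎neighbour (suc n) x y w
      ...   | inj₂ xz   = xz
      ...   | inj₁ refl = contradiction (not-true ¬w) (true⇒≢false (within-refl n x))

    DRG-valency≢0 : k ≢ 0
    DRG-valency≢0 k≡0 with DRG-edge
    ... | x , z , xz = ℕP.<-irrefl (sym (trans (regular x) k≡0)) (countF-positive (adj x) z xz)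

    DRG-β₀≡valency : getV bs 0 ≡ k
    DRG-β₀≡valency with DRG-edge
    ... | x , _ , _ = trans (sym (β-const 0 d≥1 x x (≟ᶠ-refl x))) (trans (countF-cong _ _ at-distance-1) (regular x))
      where
      at-distance-1 : ∀ z → (adj x z ∧ atDist G 1 x z) ≡ adj x z
      at-distance-1 z with adj x z in xz
      ... | false = refl
      ... | true with x ≟ᶠ z
      ...   | yes refl = contradiction (adj-irrefl x) (true⇒≢false xz)
      ...   | no  _    = cong₂ _∧_ (∃⇒anyF (λ w → adj x w ∧ ⌊ w ≟ᶠ z ⌋) z (cong₂ _∧_ xz (≟ᶠ-refl z))) refl

≤∧≤suc⇒≡⊎≡suc : ∀ {i l} → i ≤ l → l ≤ suc i → l ≡ i ⊎ l ≡ suc i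
≤∧≤suc⇒≡⊎≡suc {i} {l} i≤l l≤1+i with l ℕP.≟ suc i
... | yes l≡1+i = inj₂ l≡1+i
... | no  l≢1+i = inj₁ (ℕP.≤-antisym (ℕP.≤-pred (ℕP.≤∧≢⇒< l≤1+i l≢1+i)) i≤l)

module CliquesAcrossLayers (G : Graph) (C : Subset (Graph.V G)) {ρ : ℕ} {al : Vec ℕ (suc ρ)} {be ga : Vec ℕ ρ}
                           (crc : IsCRC G C ρ al be ga) where
  open Graph G
  open Layers G C
  open LayerFunctions G C crc

  clique-layer≤ : ∀ {K} → IsClique G K → ∀ y z a b → lookup K y ≡ true → lookup K z ≡ true →
                  InLayer a y → InLayer b z → b ≤ suc a
  clique-layer≤ clique y z a b Ky Kz ya zb with y ≟ᶠ z
  ... | yes refl = ℕP.≤-trans (ℕP.≤-reflexive (layer-unique b a y zb ya)) (ℕP.n≤1+n a)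
  ... | no  y≢z  = neighbour-layer≤ a b y z (clique y z Ky Kz y≢z) ya zb

  Spans : ℕ → Subset V → Set
  Spans j K = ∀ y → lookup K y ≡ true → InLayer j y ⊎ InLayer (suc j) y

  inC'⇒Spans : ∀ j K → inC' G C ρ j K ≡ true → Spans j K
  inC'⇒Spans j K K∈C' y Ky with allF⇒∀ (λ y → not (lookup K y) ∨ (atC G C j y ∨ atC G C (suc j) y))
                                        (proj₂ (∧-true (j <ᵇ ρ) K∈C')) y
  ... | Ky⇒ rewrite Ky = ∨-true (atC G C j y) Ky⇒

  inC'⇒< : ∀ j K → inC' G C ρ j K ≡ true → j < ρ
  inC'⇒< j K K∈C' = ℕP.<ᵇ⇒< j ρ (Equivalence.from T-≡ (proj₁ (∧-true (j <ᵇ ρ) K∈C')))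

  Spans⇒inC' : ∀ j K → j < ρ → Spans j K → inC' G C ρ j K ≡ true
  Spans⇒inC' j K j<ρ spans = cong₂ _∧_ (Equivalence.to T-≡ (ℕP.<⇒<ᵇ j<ρ)) (∀⇒allF _ in-two-layers)
    where
    in-two-layers : ∀ y → (not (lookup K y) ∨ (atC G C j y ∨ atC G C (suc j) y)) ≡ true
    in-two-layers y with lookup K y in Ky
    ... | false = refl
    ... | true with spans y Ky
    ...   | inj₁ yj   = cong (_∨ atC G C (suc j) y) yj
    ...   | inj₂ yj+1 = ∨-introʳ (atC G C j y) yj+1

  module _ (K : Subset V) (clique : IsClique G K) where
    private
      layer≤ : ∀ y z a b → lookup K y ≡ true → lookup K z ≡ true → InLayer a y → InLayer b z → b ≤ suc a
      layer≤ = clique-layer≤ {K} clique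

    Spans-below : ∀ j x → lookup K x ≡ true → InLayer (suc j) x →
                  (∀ z → lookup K z ≡ true → atC G C (suc (suc j)) z ≡ false) → Spans j K
    Spans-below j x Kx xj+1 none-above y Ky =
      Sum.map (λ l≡j → subst (λ l → InLayer l y) l≡j yl) (λ l≡j+1 → subst (λ l → InLayer l y) l≡j+1 yl)
              (≤∧≤suc⇒≡⊎≡suc j≤l l≤j+1)
      where
      l : ℕ
      l = layer y
      yl : InLayer l y
      yl = InLayer-layer y
      j≤l : j ≤ l
      j≤l = ℕP.≤-pred (layer≤ y x l (suc j) Ky Kx yl xj+1)
      l≤j+1 : l ≤ suc j
      l≤j+1 = ℕP.≤-pred (ℕP.≤∧≢⇒< (layer≤ x y (suc j) l Kx Ky xj+1 yl)
                                   (λ l≡j+2 → true⇒≢false (subst (λ l → InLayer l y) l≡j+2 yl) (none-above y Ky)))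

    Spans-across : ∀ i x z → lookup K x ≡ true → InLayer i x → lookup K z ≡ true → InLayer (suc i) z → Spans i K
    Spans-across i x z Kx xi Kz zi+1 y Ky =
      Sum.map (λ l≡i → subst (λ l → InLayer l y) l≡i yl) (λ l≡i+1 → subst (λ l → InLayer l y) l≡i+1 yl)
              (≤∧≤suc⇒≡⊎≡suc (ℕP.≤-pred (layer≤ y z (layer y) (suc i) Ky Kz yl zi+1))
                              (layer≤ x y i (layer y) Kx Ky xi yl))
      where
      yl : InLayer (layer y) y
      yl = InLayer-layer y

    nothing-two-above : ∀ j y → lookup K y ≡ true → InLayer j y →
                        ∀ z → lookup K z ≡ true → atC G C (suc (suc j)) z ≡ false
    nothing-two-above j y Ky yj z Kz =
      ¬-not (λ zj+2 → ℕP.<-irrefl refl (ℕP.≤-pred (layer≤ y z j (suc (suc j)) Ky Kz yj zj+2)))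

    inC'prev⊎inC' : 1 ≤ ρ → ∀ i x → lookup K x ≡ true → InLayer i x →
                    inC'prev G C ρ i K ≡ true ⊎ inC' G C ρ i K ≡ true
    inC'prev⊎inC' ρ≥1 zero x Kx x0 = inj₂ (Spans⇒inC' 0 K ρ≥1 spans)
      where
      spans : Spans 0 K
      spans y Ky = Sum.map (λ l≡0 → subst (λ l → InLayer l y) l≡0 (InLayer-layer y))
                                (λ l≡1 → subst (λ l → InLayer l y) l≡1 (InLayer-layer y))
                                (≤∧≤suc⇒≡⊎≡suc z≤n (layer≤ x y 0 (layer y) Kx Ky x0 (InLayer-layer y)))
    inC'prev⊎inC' ρ≥1 (suc j) x Kx xj+1 with anyF (λ z → lookup K z ∧ atC G C (suc (suc j)) z) in above
    ... | true  = let (z , Kz,zj+2) = anyF⇒∃ (λ z → lookup K z ∧ atC G C (suc (suc j)) z) above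
                      (Kz , zj+2) = ∧-true (lookup K z) Kz,zj+2
                  in inj₂ (Spans⇒inC' (suc j) K (InLayer⇒≤ρ (suc (suc j)) z zj+2) (Spans-across (suc j) x z Kx xj+1 Kz zj+2))
    ... | false = inj₁ (Spans⇒inC' j K (InLayer⇒≤ρ (suc j) x xj+1) (Spans-below j x Kx xj+1 none-above))
      where
      none-above : ∀ z → lookup K z ≡ true → atC G C (suc (suc j)) z ≡ false
      none-above z Kz = ¬-not (λ zj+2 →
        true⇒≢false (∃⇒anyF (λ z → lookup K z ∧ atC G C (suc (suc j)) z) z (cong₂ _∧_ Kz zj+2)) above)

  layerCount : Subset V → ℕ → ℕ
  layerCount K j = countF (λ y → lookup K y ∧ atC G C j y)

  Spans⇒size : ∀ j K → Spans j K → countF (lookup K) ≡ layerCount K j ℕ.+ layerCount K (suc j)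
  Spans⇒size j K spans = countF-partition (lookup K) (atC G C j) (atC G C (suc j)) spans
                                          (λ y yj → ¬InLayer (suc j) j y yj ℕP.1+n≢n)

  Spans⇒sum-lift : ∀ w j K → Spans j K →
    sumZ (λ y → if lookup K y then lift w y else + 0) ≡ + layerCount K j * w j + + layerCount K (suc j) * w (suc j)
  Spans⇒sum-lift w j K spans = begin
    sumZ (λ y → if lookup K y then lift w y else + 0)        ≡⟨ sumZ-cong _ _ by-layer ⟩
    sumZ (λ y → term j y + term (suc j) y)                   ≡⟨ sumZ-+ (term j) (term (suc j)) ⟩
    sumZ (term j) + sumZ (term (suc j))
      ≡⟨ cong₂ _+_ (sumZ-indicator (inK j) (w j)) (sumZ-indicator (inK (suc j)) (w (suc j))) ⟩
    + layerCount K j * w j + + layerCount K (suc j) * w (suc j) ∎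
    where
    open ≡-Reasoning
    inK : ℕ → Fin V → Bool
    inK l y = lookup K y ∧ atC G C l y
    term : ℕ → Fin V → ℤ
    term l y = if inK l y then w l else + 0
    by-layer : ∀ y → (if lookup K y then lift w y else + 0) ≡ term j y + term (suc j) y
    by-layer y with lookup K y in Ky
    ... | false = refl
    ... | true with spans y Ky
    ...   | inj₁ yj   rewrite yj | ¬InLayer (suc j) j y yj ℕP.1+n≢n =
            trans (lift-InLayer w j y yj) (sym (ℤP.+-identityʳ _))
    ...   | inj₂ yj+1 rewrite yj+1 | ¬InLayer j (suc j) y yj+1 (≢-sym ℕP.1+n≢n) =
            trans (lift-InLayer w (suc j) y yj+1) (sym (ℤP.+-identityˡ _))

greatestBelow : (ℕ → Bool) → ℕ → ℕ
greatestBelow p zero    = 0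
greatestBelow p (suc n) = if p (suc n) then suc n else greatestBelow p n

greatestBelow-greatest : ∀ (p : ℕ → Bool) n t → t ≤ n → p t ≡ true → t ≤ greatestBelow p n
greatestBelow-greatest p zero    t z≤n pt = z≤n
greatestBelow-greatest p (suc n) t t≤n pt with p (suc n) in pn
... | true  = t≤n
... | false with t ℕP.≟ suc n
...   | yes refl = contradiction pn (true⇒≢false pt)
...   | no  t≢n  = greatestBelow-greatest p n t (ℕP.≤-pred (ℕP.≤∧≢⇒< t≤n t≢n)) pt

greatestBelow-satisfies : ∀ (p : ℕ → Bool) n t → t ≤ n → p t ≡ true → p (greatestBelow p n) ≡ true
greatestBelow-satisfies p zero    t z≤n pt = pt
greatestBelow-satisfies p (suc n) t t≤n pt with p (suc n) in pn
... | true  = pn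
... | false with t ℕP.≟ suc n
...   | yes refl = contradiction pn (true⇒≢false pt)
...   | no  t≢n  = greatestBelow-satisfies p n t (ℕP.≤-pred (ℕP.≤∧≢⇒< t≤n t≢n)) pt

-- Division with the junk value 0 for a zero divisor.
_div_ : ℕ → ℕ → ℕ
a div zero    = 0
a div (suc q) = a ℕ./ suc q

*-div : ∀ a q → q ≢ 0 → (a ℕ.* q) div q ≡ a
*-div a zero    q≢0 = contradiction refl q≢0
*-div a (suc q) _   = m*n/n≡m a (suc q)

module _ (k : ℕ) {ρ : ℕ} (be ga : Vec ℕ ρ) where
  open IntersectionMatrix k be ga

  IsCharRoot : ℕ → Bool
  IsCharRoot t = ⌊ charPoly (- + t) (suc ρ) ℤ.≟ + 0 ⌋

  IsCharRoot-intro : ∀ t → charPoly (- + t) (suc ρ) ≡ + 0 → IsCharRoot t ≡ true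
  IsCharRoot-intro t root with charPoly (- + t) (suc ρ) ℤ.≟ + 0
  ... | yes _      = refl
  ... | no  ¬root = contradiction root ¬root

  IsCharRoot-elim : ∀ t → IsCharRoot t ≡ true → charPoly (- + t) (suc ρ) ≡ + 0
  IsCharRoot-elim t isRoot with charPoly (- + t) (suc ρ) ℤ.≟ + 0
  ... | yes root = root

  -- Recovers m = −θ: every eigenvalue of the intersection matrix is one of Γ, so θ is its least one, and m ≤ k.
  cliqueOrder : ℕ
  cliqueOrder = greatestBelow IsCharRoot k

  -- Solves m γ_{j+1} (u_j − u_{j+1}) + b (m + k) u_{j+1} = 0 for b, using β_0 ⋯ β_{i−1} u_i = u_0 p_i(−m).
  lowerCliqueFormula : ℕ → ℕ → ℕ
  lowerCliqueFormula m zero    = 0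
  lowerCliqueFormula m (suc j) =
    ℤ.∣ + m * + γ (suc j) * (charPoly (- + m) (suc j) - + β j * charPoly (- + m) j) ∣
      div ℤ.∣ (+ m + + k) * charPoly (- + m) (suc j) ∣

lowerCliqueCount : (d : ℕ) → Vec ℕ d → Vec ℕ d → (ρ : ℕ) → Vec ℕ ρ → Vec ℕ ρ → ℕ → ℕ
lowerCliqueCount d bs cs ρ be ga = lowerCliqueFormula (getV bs 0) be ga (cliqueOrder (getV bs 0) be ga)

module CodeInGeometricDRG (G : Graph) (k d : ℕ) (bs cs : Vec ℕ d) (d≥1 : 1 ≤ d) (drg : IsDRG G k d bs cs)
                          (θ : ℤ) (minθ : IsMinEigenvalue G θ)
                          (𝒦 : List (Subset (Graph.V G))) (geometric : IsGeometric G k θ 𝒦)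
                          (C : Subset (Graph.V G)) (ρ : ℕ) (al : Vec ℕ (suc ρ)) (be ga : Vec ℕ ρ)
                          (crc : IsCRC G C ρ al be ga) (θ∈Spec : InSpec ρ θ al be ga) where
  open Graph G
  open Layers G C
  open LayerFunctions G C crc
  open GeometricGraph G (IsDRG.regular drg) (DRG-valency≢0 G drg d≥1) geometric
  open CliquesAcrossLayers G C crc
  open IntersectionMatrix k be ga
  module CRC = IsCRC crc

  x₀ z₀ : Fin V
  x₀ = proj₁ (DRG-edge G drg d≥1)
  z₀ = proj₁ (proj₂ (DRG-edge G drg d≥1))

  x₀z₀ : adj x₀ z₀ ≡ true
  x₀z₀ = proj₂ (proj₂ (DRG-edge G drg d≥1))

  m : ℕ
  m = cliquesThrough x₀

  θ≡-m : θ ≡ - + m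
  θ≡-m = θ≡-cliquesThrough x₀

  cliquesThrough≡m : ∀ x → cliquesThrough x ≡ m
  cliquesThrough≡m x = ℤP.+-injective (ℤP.neg-injective (trans (sym (θ≡-cliquesThrough x)) θ≡-m))

  m*size≡m+k : ∀ {K} → K ∈ 𝒦 → + m * + countF (lookup K) ≡ + m + + k
  m*size≡m+k {K} K∈𝒦 =
    negate (+ m) (+ countF (lookup K)) (+ k) (subst (λ t → + countF (lookup K) * t ≡ t - + k) θ≡-m (proj₂ (∈𝒦⇒delsarte K∈𝒦)))
    where
    negate : ∀ m s k → s * (- m) ≡ (- m) - k → m * s ≡ m + k
    negate m s k eq = begin
      m * s          ≡⟨ flip m s ⟩
      - (s * (- m))  ≡⟨ cong -_ eq ⟩
      - ((- m) - k)  ≡⟨ unflip m k ⟩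
      m + k          ∎
      where
      open ≡-Reasoning
      flip : ∀ m s → m * s ≡ - (s * (- m))
      flip = solve-∀
      unflip : ∀ m k → - ((- m) - k) ≡ m + k
      unflip = solve-∀

  m≥1 : 1 ≤ m
  m≥1 with cliquesThrough-edge x₀ z₀ x₀z₀
  ... | K , K∈𝒦 , both = countL-positive _ 𝒦 K K∈𝒦 (proj₁ (∧-true (lookup K x₀) both))

  m≤k : m ≤ k
  m≤k with cliquesThrough-edge x₀ z₀ x₀z₀
  ... | K , K∈𝒦 , both = ℕP.+-cancelˡ-≤ m m k (begin
      m ℕ.+ m              ≡⟨ cong (m ℕ.+_) (sym (ℕP.+-identityʳ m)) ⟩
      2 ℕ.* m              ≡⟨ ℕP.*-comm 2 m ⟩
      m ℕ.* 2              ≤⟨ ℕP.*-monoʳ-≤ m size≥2 ⟩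
      m ℕ.* countF (lookup K) ≡⟨ ℤP.+-injective (trans (ℤP.pos-* m _) (m*size≡m+k K∈𝒦)) ⟩
      m ℕ.+ k              ∎)
    where
    open ℕP.≤-Reasoning
    Kx₀,Kz₀ : lookup K x₀ ≡ true × lookup K z₀ ≡ true
    Kx₀,Kz₀ = ∧-true (lookup K x₀) both
    size≥2 : 2 ≤ countF (lookup K)
    size≥2 = countF-≥2 (lookup K) x₀ z₀ (proj₁ Kx₀,Kz₀) (proj₂ Kx₀,Kz₀)
                       (λ x₀≡z₀ → true⇒≢false x₀z₀ (subst (λ z → adj x₀ z ≡ false) x₀≡z₀ (adj-irrefl x₀)))

  layer-nonempty : ∀ i → i ≤ ρ → ∃ λ x → InLayer i x
  layer-nonempty = layer-nonempty-below ρ CRC.radius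

  β-positive : ∀ j → j < ρ → 1 ≤ β j
  β-positive j j<ρ with layer-nonempty (suc j) j<ρ
  ... | z , zj+1 with down-neighbour j z zj+1
  ...   | y , zy , yj = subst (1 ≤_) (CRC.β-const j j<ρ y yj) (countF-positive _ z (cong₂ _∧_ (trans (adj-sym y z) zy) zj+1))

  γ-positive : ∀ j → j < ρ → 1 ≤ getV ga j
  γ-positive j j<ρ with layer-nonempty (suc j) j<ρ
  ... | z , zj+1 with down-neighbour j z zj+1
  ...   | y , zy , yj = subst (1 ≤_) (CRC.γ-const j j<ρ z zj+1) (countF-positive _ y (cong₂ _∧_ zy yj))

  α≡k-β-γ : ∀ i → i ≤ ρ → + getV al i ≡ α i
  α≡k-β-γ i i≤ρ with layer-nonempty i i≤ρ
  ... | x , xi = isolate (+ k) (+ γ i) (+ getV al i) (+ β i) (trans (sym valency) (trans (neighbourSum-lift one i x xi) (rowSum i)))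
    where
    one : ℕ → ℤ
    one _ = + 1
    valency : A· G (lift one) x ≡ + k
    valency = trans (sym (countF≡sumZ (adj x))) (cong +_ (IsDRG.regular drg x))
    rowSum : ∀ i → triRow al be ga one i ≡ + γ i + + getV al i + + β i
    rowSum zero    = cong₂ (λ a b → + 0 + a + b) (ℤP.*-identityʳ (+ getV al 0)) (ℤP.*-identityʳ (+ β 0))
    rowSum (suc j) = cong₂ _+_ (cong₂ _+_ (ℤP.*-identityʳ (+ γ (suc j))) (ℤP.*-identityʳ (+ getV al (suc j))))
                               (ℤP.*-identityʳ (+ β (suc j)))
    isolate : ∀ k g a b → k ≡ g + a + b → a ≡ k - b - g
    isolate k g a b refl = ring g a b
      where
      ring : ∀ g a b → a ≡ g + a + b - b - g
      ring = solve-∀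

  open WithDiagonal al α≡k-β-γ

  u : ℕ → ℤ
  u = proj₁ θ∈Spec

  u-rows : ∀ i → i ≤ ρ → triRow al be ga u i ≡ θ * u i
  u-rows = proj₂ (proj₂ θ∈Spec)

  open Eigenvector θ u u-rows

  u₀≢0 : u 0 ≢ + 0
  u₀≢0 = let (i , i≤ρ , ui≢0) = proj₁ (proj₂ θ∈Spec) in eigenvector-head≢0 β-positive i i≤ρ ui≢0

  θ-root : charPoly θ (suc ρ) ≡ + 0
  θ-root = eigenvector⇒charPoly-root u₀≢0

  f : Fin V → ℤ
  f = lift u

  f-eigen : ∀ x → A· G f x ≡ θ * f x
  f-eigen = lift-eigenvector u θ u-rows

  root⇒≤m : ∀ t → charPoly (- + t) (suc ρ) ≡ + 0 → t ≤ m
  root⇒≤m t root = drop+ (ℤP.neg-cancel-≤ (subst (ℤ._≤ - + t) θ≡-m θ≤-t))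
    where
    open Root (- + t) root
    drop+ : ∀ {a b} → + a ℤ.≤ + b → a ≤ b
    drop+ (ℤ.+≤+ a≤b) = a≤b
    x : Fin V
    x = proj₁ (layer-nonempty 0 z≤n)
    θ≤-t : θ ℤ.≤ - + t
    θ≤-t = minEigenvalue-≤ G minθ (lift rootVector) (- + t) x (lift-eigenvector rootVector (- + t) rootVector-rows)
             (λ eq → rootVector-head≢0 β-positive (trans (sym (lift-InLayer rootVector 0 x (proj₂ (layer-nonempty 0 z≤n)))) eq))

  ρ≥1 : 1 ≤ ρ
  ρ≥1 with ρ ℕP.≟ 0
  ... | no  ρ≢0 = ℕP.n≢0⇒n>0 ρ≢0
  ... | yes ρ≡0 = contradiction (trans (sym θ≡k) θ≡-m) (k≢-m m≥1)
    where
    β₀≡0 : β 0 ≡ 0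
    β₀≡0 = subst (λ r → getV be r ≡ 0) ρ≡0 (getV-outside be)
    θ≡k : θ ≡ + k
    θ≡k = trans (ℤP.i-j≡0⇒i≡j θ (α 0) (subst (λ r → charPoly θ (suc r) ≡ + 0) ρ≡0 θ-root))
                (trans (cong (λ b → + k - + b - + 0) β₀≡0) (trans (ℤP.+-identityʳ (+ k - + 0)) (ℤP.+-identityʳ (+ k))))
    k≢-m : ∀ {k m} → 1 ≤ m → + k ≢ - + m
    k≢-m {m = suc m} _ ()

  lowerClique : Fin V → ℕ → Subset V → Bool
  lowerClique x j K = lookup K x ∧ inC' G C ρ j K

  lowerCliques : Fin V → ℕ → ℕ
  lowerCliques x j = countL (lowerClique x j) 𝒦

  -- Each neighbour of x in C_j lies in exactly one clique through x, and that clique is in C'_j.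
  γ≡sum-lowerCliques : ∀ j x → suc j ≤ ρ → InLayer (suc j) x →
    + γ (suc j) ≡ sumL (λ K → if lowerClique x j K then + layerCount K j else + 0) 𝒦
  γ≡sum-lowerCliques j x j<ρ xj+1 = begin
    + γ (suc j)
      ≡⟨ cong +_ (sym (CRC.γ-const j j<ρ x xj+1)) ⟩
    + countF (neighbourIn j x)
      ≡⟨ countF≡sumZ (neighbourIn j x) ⟩
    sumZ (λ y → if neighbourIn j x y then + 1 else + 0)
      ≡⟨ sumZ-cong _ _ count-by-clique ⟩
    sumZ (λ y → sumL (λ K → if atC G C j y ∧ (lookup K x ∧ lookup K y) then + 1 else + 0) 𝒦)
      ≡⟨ sumZ-sumL (λ y K → if atC G C j y ∧ (lookup K x ∧ lookup K y) then + 1 else + 0) 𝒦 ⟩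
    sumL (λ K → sumZ (λ y → if atC G C j y ∧ (lookup K x ∧ lookup K y) then + 1 else + 0)) 𝒦
      ≡⟨ sumL-cong _ _ 𝒦 clique-contribution ⟩
    sumL (λ K → if lowerClique x j K then + layerCount K j else + 0) 𝒦 ∎
    where
    open ≡-Reasoning
    count-by-clique : ∀ y → (if neighbourIn j x y then + 1 else + 0)
                            ≡ sumL (λ K → if atC G C j y ∧ (lookup K x ∧ lookup K y) then + 1 else + 0) 𝒦
    count-by-clique y with atC G C j y in yj
    ... | false rewrite ∧-zeroʳ (adj x y) = sym (sumL-zero _ 𝒦 (λ _ _ → refl))
    ... | true  = trans (cong (λ b → if b then + 1 else + 0) (∧-identityʳ (adj x y)))
                        (trans (sym (commonCliques-distinct x y x≢y)) (countL≡sumL _ 𝒦))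
      where
      x≢y : x ≢ y
      x≢y refl = true⇒≢false yj (¬InLayer j (suc j) x xj+1 (≢-sym ℕP.1+n≢n))

    clique-contribution : ∀ K → K ∈ 𝒦 → sumZ (λ y → if atC G C j y ∧ (lookup K x ∧ lookup K y) then + 1 else + 0)
                                          ≡ (if lowerClique x j K then + layerCount K j else + 0)
    clique-contribution K K∈𝒦 with lookup K x in Kx
    ... | false = sumZ-zero _ (λ y → cong (λ b → if b then + 1 else + 0) (∧-zeroʳ (atC G C j y)))
    ... | true  = trans (sumZ-cong _ _ (λ y → cong (λ b → if b then + 1 else + 0) (∧-comm (atC G C j y) (lookup K y))))
                        (trans (sym (countF≡sumZ (λ y → lookup K y ∧ atC G C j y))) (by-membership (inC' G C ρ j K) refl))
      where
      by-membership : ∀ b → inC' G C ρ j K ≡ b → + layerCount K j ≡ (if b then + layerCount K j else + 0)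
      by-membership true  _      = refl
      by-membership false K∉C'ⱼ = cong +_ (countF-none _ (λ y → ¬-not (λ Ky,yj →
        let (Ky , yj) = ∧-true (lookup K y) Ky,yj
            clique = proj₁ (∈𝒦⇒delsarte K∈𝒦)
        in true⇒≢false (Spans⇒inC' j K j<ρ (Spans-below K clique j x Kx xj+1 (nothing-two-above K clique j y Ky yj))) K∉C'ⱼ)))

  cliqueOrder≡m : cliqueOrder k be ga ≡ m
  cliqueOrder≡m = ℕP.≤-antisym
    (root⇒≤m _ (IsCharRoot-elim k be ga _ (greatestBelow-satisfies (IsCharRoot k be ga) k m m≤k m-root)))
    (greatestBelow-greatest (IsCharRoot k be ga) k m m≤k m-root)
    where
    m-root : IsCharRoot k be ga m ≡ true
    m-root = IsCharRoot-intro k be ga m (subst (λ t → charPoly t (suc ρ) ≡ + 0) θ≡-m θ-root)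

  lowerClique-balance : ∀ j x K → K ∈ 𝒦 → lowerClique x j K ≡ true →
    + m * (+ layerCount K j * (u j - u (suc j))) + (+ m + + k) * u (suc j) ≡ + 0
  lowerClique-balance j x K K∈𝒦 lower =
    balance (+ m) (+ layerCount K j) (+ layerCount K (suc j)) (+ k) (u j) (u (suc j))
      (trans (cong (λ n → + m * + n) (sym (Spans⇒size j K spans))) (m*size≡m+k K∈𝒦))
      (trans (cong (+ m *_) (sym (Spans⇒sum-lift u j K spans)))
             (trans (cong (+ m *_) (cliqueSum-zero f f-eigen K K∈𝒦)) (ℤP.*-zeroʳ (+ m))))
    where
    spans : Spans j K
    spans = inC'⇒Spans j K (proj₂ (∧-true (lookup K x) lower))
    balance : ∀ M a b K v w → M * (a + b) ≡ M + K → M * (a * v + b * w) ≡ + 0 →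
              M * (a * (v - w)) + (M + K) * w ≡ + 0
    balance M a b K v w size sum = begin
      M * (a * (v - w)) + (M + K) * w        ≡⟨ cong (λ s → M * (a * (v - w)) + s * w) (sym size) ⟩
      M * (a * (v - w)) + M * (a + b) * w    ≡⟨ ring M a b v w ⟩
      M * (a * v + b * w)                    ≡⟨ sum ⟩
      + 0                                    ∎
      where
      open ≡-Reasoning
      ring : ∀ M a b v w → M * (a * (v - w)) + M * (a + b) * w ≡ M * (a * v + b * w)
      ring = solve-∀

  layer-balance : ∀ j x → suc j ≤ ρ → InLayer (suc j) x →
    + m * (u j - u (suc j)) * + γ (suc j) + + lowerCliques x j * ((+ m + + k) * u (suc j)) ≡ + 0
  layer-balance j x j<ρ xj+1 = sym (begin
    + 0
      ≡⟨ sym (sumL-zero _ 𝒦 each-zero) ⟩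
    sumL (λ K → if lowerClique x j K then + m * (+ layerCount K j * δ) + Q else + 0) 𝒦
      ≡⟨ sumL-cong _ _ 𝒦 (λ K _ → split K) ⟩
    sumL (λ K → + m * δ * (if lowerClique x j K then + layerCount K j else + 0) + (if lowerClique x j K then Q else + 0)) 𝒦
      ≡⟨ sumL-+ _ _ 𝒦 ⟩
    sumL (λ K → + m * δ * (if lowerClique x j K then + layerCount K j else + 0)) 𝒦
      + sumL (λ K → if lowerClique x j K then Q else + 0) 𝒦
      ≡⟨ cong₂ _+_ (trans (sumL-*ˡ (+ m * δ) _ 𝒦) (cong (+ m * δ *_) (sym (γ≡sum-lowerCliques j x j<ρ xj+1))))
                   (sumL-indicator (lowerClique x j) Q 𝒦) ⟩
    + m * δ * + γ (suc j) + + lowerCliques x j * Q ∎)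
    where
    open ≡-Reasoning
    δ Q : ℤ
    δ = u j - u (suc j)
    Q = (+ m + + k) * u (suc j)
    each-zero : ∀ K → K ∈ 𝒦 → (if lowerClique x j K then + m * (+ layerCount K j * δ) + Q else + 0) ≡ + 0
    each-zero K K∈𝒦 with lowerClique x j K in lower
    ... | true  = lowerClique-balance j x K K∈𝒦 lower
    ... | false = refl
    split : ∀ K → (if lowerClique x j K then + m * (+ layerCount K j * δ) + Q else + 0)
                  ≡ + m * δ * (if lowerClique x j K then + layerCount K j else + 0) + (if lowerClique x j K then Q else + 0)
    split K with lowerClique x j K
    ... | true  = cong (_+ Q) (ring (+ m) (+ layerCount K j) δ)
      where
      ring : ∀ a b c → a * (b * c) ≡ a * c * b
      ring = solve-∀
    ... | false = sym (trans (ℤP.+-identityʳ _) (ℤP.*-zeroʳ (+ m * δ)))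

  u≢0 : ∀ i → i ≤ ρ → u i ≢ + 0
  u≢0 zero    _   = u₀≢0
  u≢0 (suc j) j<ρ uj+1≡0 with layer-nonempty (suc j) j<ρ
  ... | x , xj+1 = u≢0 j (ℕP.<⇒≤ j<ρ)
    (*≡0-cancelˡ (+ m) (λ eq → ℕP.<-irrefl (sym (ℤP.+-injective eq)) m≥1)
    (*≡0-cancelˡ (+ γ (suc j)) (λ eq → ℕP.<-irrefl (sym (ℤP.+-injective eq)) (γ-positive j j<ρ))
    (trans (ring (+ γ (suc j)) (+ m) (u j) (+ lowerCliques x j) (+ m + + k))
           (trans (cong (λ w → + m * (u j - w) * + γ (suc j) + + lowerCliques x j * ((+ m + + k) * w)) (sym uj+1≡0))
                  (layer-balance j x j<ρ xj+1)))))
    where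
    ring : ∀ g M v D S → g * (M * v) ≡ M * (v - + 0) * g + D * (S * + 0)
    ring = solve-∀

  p : ℕ → ℤ
  p = charPoly (- + m)

  u-scaled′ : ∀ i → i ≤ suc ρ → + βProduct i * u i ≡ u 0 * p i
  u-scaled′ i i≤ρ+1 = subst (λ t → + βProduct i * u i ≡ u 0 * charPoly t i) θ≡-m (eigenvector-scaled i i≤ρ+1)

  p≢0 : ∀ i → i ≤ ρ → p i ≢ + 0
  p≢0 i i≤ρ pi≡0 = u≢0 i i≤ρ (*≡0-cancelˡ (+ βProduct i) (βProduct≢0 β-positive i i≤ρ)
                                (trans (u-scaled′ i (ℕP.m≤n⇒m≤1+n i≤ρ)) (trans (cong (u 0 *_) pi≡0) (ℤP.*-zeroʳ (u 0)))))

  lowerCliques-equation : ∀ j x → suc j ≤ ρ → InLayer (suc j) x →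
    + lowerCliques x j * ((+ m + + k) * p (suc j)) ≡ + m * + γ (suc j) * (p (suc j) - + β j * p j)
  lowerCliques-equation j x j<ρ xj+1 = ℤP.i-j≡0⇒i≡j _ _ (*≡0-cancelˡ (u 0) u₀≢0 (begin
    u 0 * (D * (S * p (suc j)) - M * g * (p (suc j) - b * p j))
      ≡⟨ expand (u 0) D S M g b (p (suc j)) (p j) ⟩
    D * S * (u 0 * p (suc j)) - M * g * (u 0 * p (suc j)) + M * g * b * (u 0 * p j)
      ≡⟨ cong₂ (λ P P′ → D * S * P - M * g * P + M * g * b * P′)
               (sym (trans (cong (_* u (suc j)) (sym (βProduct-suc j))) (u-scaled′ (suc j) (ℕP.m≤n⇒m≤1+n j<ρ))))
               (sym (u-scaled′ j (ℕP.m≤n⇒m≤1+n (ℕP.<⇒≤ j<ρ)))) ⟩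
    D * S * (B * b * u (suc j)) - M * g * (B * b * u (suc j)) + M * g * b * (B * u j)
      ≡⟨ collect D M S g b B (u j) (u (suc j)) ⟩
    B * b * (M * (u j - u (suc j)) * g + D * (S * u (suc j)))
      ≡⟨ cong (B * b *_) (layer-balance j x j<ρ xj+1) ⟩
    B * b * + 0
      ≡⟨ ℤP.*-zeroʳ (B * b) ⟩
    + 0 ∎))
    where
    open ≡-Reasoning
    D M S g b B : ℤ
    D = + lowerCliques x j
    M = + m
    S = + m + + k
    g = + γ (suc j)
    b = + β j
    B = + βProduct j
    expand : ∀ u₀ D S M g b P P′ → u₀ * (D * (S * P) - M * g * (P - b * P′))
                                  ≡ D * S * (u₀ * P) - M * g * (u₀ * P) + M * g * b * (u₀ * P′)
    expand = solve-∀
    collect : ∀ D M S g b B v w → D * S * (B * b * w) - M * g * (B * b * w) + M * g * b * (B * v)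
                                  ≡ B * b * (M * (v - w) * g + D * (S * w))
    collect = solve-∀

  lowerCliqueFormula≡lowerCliques : ∀ j x → suc j ≤ ρ → InLayer (suc j) x →
                                    lowerCliqueFormula k be ga m (suc j) ≡ lowerCliques x j
  lowerCliqueFormula≡lowerCliques j x j<ρ xj+1 = trans
    (cong (_div ℤ.∣ (+ m + + k) * p (suc j) ∣)
          (trans (cong ℤ.∣_∣ (sym (lowerCliques-equation j x j<ρ xj+1))) (ℤP.abs-* (+ lowerCliques x j) _)))
    (*-div (lowerCliques x j) _ (λ eq → p≢0 (suc j) j<ρ (*≡0-cancelˡ (+ m + + k) m+k≢0 (ℤP.∣i∣≡0⇒i≡0 eq))))
    where
    m+k≢0 : + m + + k ≢ + 0
    m+k≢0 eq = ℕP.<-irrefl (sym (ℤP.+-injective eq)) (ℕP.≤-trans m≥1 (ℕP.m≤m+n m k))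

  lowerCliqueCount≡formula : lowerCliqueCount d bs cs ρ be ga ≡ lowerCliqueFormula k be ga m
  lowerCliqueCount≡formula = begin
    lowerCliqueCount d bs cs ρ be ga
      ≡⟨ cong (λ k′ → lowerCliqueFormula k′ be ga (cliqueOrder k′ be ga)) (DRG-β₀≡valency G drg d≥1) ⟩
    lowerCliqueFormula k be ga (cliqueOrder k be ga)
      ≡⟨ cong (lowerCliqueFormula k be ga) cliqueOrder≡m ⟩
    lowerCliqueFormula k be ga m ∎
    where open ≡-Reasoning

  lowerCliqueCount≡lowerCliques : ∀ j x → suc j ≤ ρ → InLayer (suc j) x →
                                  lowerCliqueCount d bs cs ρ be ga (suc j) ≡ lowerCliques x j
  lowerCliqueCount≡lowerCliques j x j<ρ xj+1 =
    trans (cong-app lowerCliqueCount≡formula (suc j)) (lowerCliqueFormula≡lowerCliques j x j<ρ xj+1)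

  +m≡-θ : + m ≡ - θ
  +m≡-θ = trans (sym (ℤP.neg-involutive (+ m))) (cong -_ (sym θ≡-m))

  lowerClique-of-downEdge : ∀ j x y K → K ∈ 𝒦 → InLayer (suc j) x → InLayer j y →
                            (lookup K x ∧ lookup K y) ≡ true → lowerClique x j K ≡ true
  lowerClique-of-downEdge j x y K K∈𝒦 xj+1 yj both =
    cong₂ _∧_ Kx (Spans⇒inC' j K (InLayer⇒≤ρ (suc j) x xj+1)
                    (Spans-below K clique j x Kx xj+1 (nothing-two-above K clique j y Ky yj)))
    where
    clique : IsClique G K
    clique = proj₁ (∈𝒦⇒delsarte K∈𝒦)
    Kx : lookup K x ≡ true
    Kx = proj₁ (∧-true (lookup K x) both)
    Ky : lookup K y ≡ true
    Ky = proj₂ (∧-true (lookup K x) both)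

  upper-clique-not-lower : ∀ j z K → InLayer (suc (suc j)) z → lookup K z ≡ true → inC' G C ρ j K ≡ false
  upper-clique-not-lower j z K zj+2 Kz = ¬-not (λ K∈C'ⱼ →
    [ (λ zj → ℕP.m≢1+n+m j (sym (layer-unique (suc (suc j)) j z zj+2 zj)))
    , (λ zj+1 → ℕP.1+n≢n (layer-unique (suc (suc j)) (suc j) z zj+2 zj+1))
    ]′
      (inC'⇒Spans j K K∈C'ⱼ z Kz))

  lowerCliques-bounds : ∀ j x → suc (suc j) ≤ ρ → InLayer (suc j) x → 1 ≤ lowerCliques x j × lowerCliques x j < m
  lowerCliques-bounds j x j+1<ρ xj+1 = at-least-one , fewer-than-m
    where
    at-least-one : 1 ≤ lowerCliques x j
    at-least-one with down-neighbour j x xj+1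
    ... | y , xy , yj with cliquesThrough-edge x y xy
    ...   | K , K∈𝒦 , both = countL-positive (lowerClique x j) 𝒦 K K∈𝒦 (lowerClique-of-downEdge j x y K K∈𝒦 xj+1 yj both)
    fewer-than-m : lowerCliques x j < m
    fewer-than-m with countF-positive⇒∃ (neighbourIn (suc (suc j)) x)
                        (subst (1 ≤_) (sym (CRC.β-const (suc j) j+1<ρ x xj+1)) (β-positive (suc j) j+1<ρ))
    ... | z , xz,zj+2 with ∧-true (adj x z) xz,zj+2
    ...   | xz , zj+2 with cliquesThrough-edge x z xz
    ...     | K , K∈𝒦 , both = begin-strict
      lowerCliques x j                                                          <⟨ ℕP.m<m+n _ upper-exists ⟩
      lowerCliques x j ℕ.+ countL (λ K → lookup K x ∧ not (inC' G C ρ j K)) 𝒦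
        ≡⟨ sym (countL-∧-split (λ K → lookup K x) (inC' G C ρ j) 𝒦) ⟩
      cliquesThrough x                                                          ≡⟨ cliquesThrough≡m x ⟩
      m                                                                         ∎
      where
      open ℕP.≤-Reasoning
      upper-exists : 0 < countL (λ K → lookup K x ∧ not (inC' G C ρ j K)) 𝒦
      upper-exists = countL-positive _ 𝒦 K K∈𝒦
        (cong₂ _∧_ (proj₁ (∧-true (lookup K x) both))
                   (cong not (upper-clique-not-lower j z K zj+2 (proj₂ (∧-true (lookup K x) both)))))

  lowerCliques-top : ∀ j x → suc j ≡ ρ → InLayer (suc j) x → lowerCliques x j ≡ m
  lowerCliques-top j x j+1≡ρ xj+1 = trans (countL-cong _ _ 𝒦 all-lower) (cliquesThrough≡m x)
    where
    all-lower : ∀ K → K ∈ 𝒦 → lowerClique x j K ≡ lookup K x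
    all-lower K K∈𝒦 with lookup K x in Kx
    ... | false = refl
    ... | true with inC'prev⊎inC' K (proj₁ (∈𝒦⇒delsarte K∈𝒦)) ρ≥1 (suc j) x Kx xj+1
    ...   | inj₁ K∈C'ⱼ   = K∈C'ⱼ
    ...   | inj₂ K∈C'ⱼ₊₁ = contradiction (inC'⇒< (suc j) K K∈C'ⱼ₊₁) (ℕP.<-irrefl j+1≡ρ)

  b : ℕ → ℕ
  b = lowerCliqueCount d bs cs ρ be ga

  b-top : + b ρ ≡ - θ
  b-top = subst (λ r → + b r ≡ - θ) ρ-1+1≡ρ (begin
    + b (suc j)          ≡⟨ cong +_ (lowerCliqueCount≡lowerCliques j x (ℕP.≤-reflexive ρ-1+1≡ρ) xρ) ⟩
    + lowerCliques x j   ≡⟨ cong +_ (lowerCliques-top j x ρ-1+1≡ρ xρ) ⟩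
    + m                  ≡⟨ +m≡-θ ⟩
    - θ                  ∎)
    where
    open ≡-Reasoning
    j : ℕ
    j = ℕ.pred ρ
    ρ-1+1≡ρ : suc j ≡ ρ
    ρ-1+1≡ρ = ℕP.suc-pred ρ {{ℕ.>-nonZero ρ≥1}}
    x : Fin V
    x = proj₁ CRC.radius
    xρ : InLayer (suc j) x
    xρ = subst (λ r → InLayer r x) (sym ρ-1+1≡ρ) (proj₂ CRC.radius)

  b-between : ∀ i → 1 ≤ i → i < ρ → (0 < b i) × (+ b i ℤ.< - θ)
  b-between (suc j) _ j+1<ρ =
    subst (0 <_) (sym b≡lower) ≥1 ,
    subst (ℤ._< - θ) (cong +_ (sym b≡lower)) (subst (+ lowerCliques x j ℤ.<_) +m≡-θ (ℤ.+<+ <m))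
    where
    x : Fin V
    x = proj₁ (layer-nonempty (suc j) (ℕP.<⇒≤ j+1<ρ))
    xj+1 : InLayer (suc j) x
    xj+1 = proj₂ (layer-nonempty (suc j) (ℕP.<⇒≤ j+1<ρ))
    b≡lower : b (suc j) ≡ lowerCliques x j
    b≡lower = lowerCliqueCount≡lowerCliques j x (ℕP.<⇒≤ j+1<ρ) xj+1
    ≥1 : 1 ≤ lowerCliques x j
    ≥1 = proj₁ (lowerCliques-bounds j x j+1<ρ xj+1)
    <m : lowerCliques x j < m
    <m = proj₂ (lowerCliques-bounds j x j+1<ρ xj+1)

  cliques-at-layer : ∀ i → i ≤ ρ → ∀ x → InLayer i x →
    (∀ K → K ∈ 𝒦 → lookup K x ≡ true → inC'prev G C ρ i K ≡ true ⊎ inC' G C ρ i K ≡ true)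
    × (countL (λ K → lookup K x ∧ inC'prev G C ρ i K) 𝒦 ≡ b i)
  cliques-at-layer i i≤ρ x xi =
    (λ K K∈𝒦 Kx → inC'prev⊎inC' K (proj₁ (∈𝒦⇒delsarte K∈𝒦)) ρ≥1 i x Kx xi) , count i i≤ρ xi
    where
    count : ∀ i → i ≤ ρ → InLayer i x → countL (λ K → lookup K x ∧ inC'prev G C ρ i K) 𝒦 ≡ b i
    count zero    _   _    = countL-none _ 𝒦 (λ K _ → ∧-zeroʳ (lookup K x))
    count (suc j) j<ρ xj+1 = sym (lowerCliqueCount≡lowerCliques j x j<ρ xj+1)

lemma2 : Σ[ b ∈ ((d : ℕ) → Vec ℕ d → Vec ℕ d → (ρ : ℕ) → Vec ℕ ρ → Vec ℕ ρ → ℕ → ℕ) ]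
    ∀ (G : Graph) (k d : ℕ) (bs cs : Vec ℕ d) → 1 ≤ d → IsDRG G k d bs cs →
    ∀ (θ : ℤ) → IsMinEigenvalue G θ →
    ∀ (𝒦 : List (Subset (Graph.V G))) → IsGeometric G k θ 𝒦 →
    ∀ (C : Subset (Graph.V G)) (ρ : ℕ) (al : Vec ℕ (suc ρ)) (be ga : Vec ℕ ρ) →
    IsCRC G C ρ al be ga → InSpec ρ θ al be ga →
    (b d bs cs ρ be ga 0 ≡ 0)
    × ((+ b d bs cs ρ be ga ρ) ≡ - θ)
    × (∀ i → 1 ≤ i → i < ρ → (0 < b d bs cs ρ be ga i) × ((+ b d bs cs ρ be ga i) ℤ.< - θ))
    × (∀ i → i ≤ ρ → ∀ (x : Fin (Graph.V G)) → atC G C i x ≡ true →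
         (∀ K → K ∈ 𝒦 → lookup K x ≡ true →
            inC'prev G C ρ i K ≡ true ⊎ inC' G C ρ i K ≡ true)
         × (countL (λ K → lookup K x ∧ inC'prev G C ρ i K) 𝒦 ≡ b d bs cs ρ be ga i))
lemma2 = lowerCliqueCount , λ G k d bs cs d≥1 drg θ minθ 𝒦 geometric C ρ al be ga crc θ∈Spec →
  let open CodeInGeometricDRG G k d bs cs d≥1 drg θ minθ 𝒦 geometric C ρ al be ga crc θ∈Spec
  in refl , b-top , b-between , cliques-at-layer
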